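{- For all integers $1\le k\le n$, $$V_{n,k}(t)=\sum_{\sigma\in\mathcal{VS}^{(B)}_{n,n-k+1}}t^{\,n+1-2\cdot \mathsf{neg}(\sigma)}\qquad\text{and}\qquad V_{n,-k}(t)=\sum_{\sigma\in\mathcal{VS}^{(D)}_{n,n-k+1}}t^{\,n+1-2\cdot \mathsf{neg}(\sigma)}.$$
   Context: Arnold–Hoffman polynomials: for integers $1\le |k|\le n$ define $V_{n,k}(t)$ by $V_{1,1}=t^2$, $V_{1,-1}=1$, $V_{n,-n}=0$ for $n\ge 2$, and $V_{n,-k}=V_{n,-k-1}+t^{ -1}V_{n-1,k}$ for $n>k\ge 1$; $V_{n,1}=t^2V_{n,-1}$ for $n\ge2$; $V_{n,k}=V_{n,k-1}+tV_{n-1,-k+1}$ for $n\ge k>1$. A signed permutation of $[n]$ is written in window notation $\sigma=\sigma_1\cdots\sigma_n$ ($\sigma_i=\sigma(i)\in[\pm n]$, $|\sigma_1|,\dots,|\sigma_n|$ a permutation of $[n]$); $\bar a=-a$; $|\sigma|=|\sigma_1|\cdots|\sigma_n|$. For a sequence $w=w_1\cdots w_n$ of distinct positive integers, position $i$ (or $w_i$) is a valley if $2\le i\le n-1$ and $w_{i-1}>w_i<w_{i+1}$, or $i=1$ and $w_1<w_2$. $\mathcal{VS}^{(B)}_n$: signed permutations $\sigma$ such that whenever $\sigma_i<0$, we have $i\ge2$ and $|\sigma_{i-1}|$ is a valley of $|\sigma|$ (in particular $\sigma_1>0$). $\mathcal{VS}^{(B)}_{n,k}$: those with $\sigma_1=k$.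 $\mathcal{VS}^{(D)}_n$: signed permutations $\sigma$ with $\sigma_1<0$, $|\sigma_1|>\sigma_2>0$ (when $n\ge 2$), and such that for $i\ge 3$, $\sigma_i<0$ implies $|\sigma_{i-1}|$ is a valley of $|\sigma|$. $\mathcal{VS}^{(D)}_{n,k}$: those with $\sigma_1=\bar k$. $\mathsf{neg}(\sigma)=\#\{i:\sigma_i<0\}$. -}

module Defs where

open import Data.Nat as ℕ using (ℕ; zero; suc; _+_; _*_; _∸_)
import Data.Nat.Properties as ℕP
open import Data.Integer as ℤ using (ℤ; +_; -[1+_]; ∣_∣)
import Data.Integer.Properties as ℤP
open import Data.List using (List; []; _∷_; map; length; filter; concatMap; upTo; _++_; foldr)
open import Data.List.Relation.Unary.All using (All)
import Data.List.Relation.Unary.All as All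
open import Data.List.Relation.Unary.Unique.Propositional using (Unique)
import Data.List.Relation.Unary.Unique.DecPropositional as UDec
open import Data.Product using (_×_; _,_)
open import Data.Sum using (_⊎_)
open import Relation.Nullary using (Dec; yes; no)
open import Relation.Nullary.Decidable using (_×-dec_; _⊎-dec_; _→-dec_)
open import Relation.Binary.PropositionalEquality using (_≡_)

-- Laurent polynomials in t with natural-number coefficients,
-- represented by their coefficient function:  p e = coefficient of t^e.

LPoly : Set
LPoly = ℤ → ℕ

0ᴸ : LPoly
0ᴸ _ = 0

mono : ℤ → LPoly
mono d e with e ℤ.≟ d
... | yes _ = 1
... | no  _ = 0

1ᴸ : LPoly
1ᴸ = mono (+ 0)

infixl 6 _⊕_
_⊕_ : LPoly → LPoly → LPoly
(p ⊕ q) e = p e + q e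

shift : ℤ → LPoly → LPoly
shift d p e = p (e ℤ.- d)

sumᴸ : List LPoly → LPoly
sumᴸ = foldr _⊕_ 0ᴸ

-- Vpos n k      = V_{n,k}
--   Vneg n k      = V_{n,-k}
--   negAux m d    = V_{m+1, -(m+1-d)}   (m ≥ 1), computed by increasing d
-- Values outside 1 ≤ k ≤ n are irrelevant (set to 0).

mutual
  Vpos : ℕ → ℕ → LPoly
  Vpos zero _ = 0ᴸ
  Vpos (suc m) zero = 0ᴸ
  Vpos (suc zero) (suc zero) = mono (+ 2)
  Vpos (suc (suc m)) (suc zero) = shift (+ 2) (Vneg (suc (suc m)) 1)
  Vpos (suc m) (suc (suc k)) =                                          -- V_{n,k} = V_{n,k-1} + t V_{n-1,-(k-1)}
    Vpos (suc m) (suc k) ⊕ shift (+ 1) (Vneg m (suc k))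

  Vneg : ℕ → ℕ → LPoly
  Vneg zero _ = 0ᴸ
  Vneg (suc zero) _ = 1ᴸ
  Vneg (suc (suc m)) k = negAux (suc m) (suc (suc m) ∸ k)

  negAux : ℕ → ℕ → LPoly
  negAux m zero = 0ᴸ                                                   -- V_{n,-n} = 0 (n ≥ 2)
  negAux m (suc d) =                                                    -- V_{n,-k} = V_{n,-k-1} + t^{-1} V_{n-1,k}
    negAux m d ⊕ shift (ℤ.- (+ 1)) (Vpos m (m ∸ d))

V : ℕ → ℤ → LPoly
V n (+ k) = Vpos n k
V n -[1+ k ] = Vneg n (suc k)

-- Signed permutations in window notation: lists σ = σ₁ ⋯ σₙ of integers.

-- 1-indexed lookup (default value used only out of range)
_!_ : ∀ {A : Set} → {{A}} → List A → ℕ → A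
_!_ {{d}} [] _ = d
_!_ {{d}} (x ∷ xs) zero = d
_!_ {{d}} (x ∷ xs) (suc zero) = x
_!_ {{d}} (x ∷ xs) (suc (suc i)) = _!_ {{d}} xs (suc i)

instance
  defℕ : ℕ
  defℕ = 0
  defℤ : ℤ
  defℤ = + 0

positions : ℕ → List ℕ
positions n = map suc (upTo n)

absList : List ℤ → List ℕ
absList = map ∣_∣

-- σ is a signed permutation of [n]: length n, entries in [±n], and
-- |σ₁|,…,|σₙ| pairwise distinct (hence a permutation of [n]).
SignedPerm : ℕ → List ℤ → Set
SignedPerm n σ = length σ ≡ n × All (λ x → 1 ℕ.≤ ∣ x ∣ × ∣ x ∣ ℕ.≤ n) σ × Unique (absList σ)

Valley : List ℕ → ℕ → Set
Valley w i =
  (2 ℕ.≤ i × i + 1 ℕ.≤ length w × w ! i ℕ.< w ! (i ∸ 1) × w ! i ℕ.< w ! suc i)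
  ⊎ (i ≡ 1 × 2 ℕ.≤ length w × w ! 1 ℕ.< w ! 2)

VSB : ℕ → ℕ → List ℤ → Set
VSB n k σ =
  SignedPerm n σ × σ ! 1 ≡ + k ×
  All (λ i → σ ! i ℤ.< + 0 → 2 ℕ.≤ i × Valley (absList σ) (i ∸ 1)) (positions n)

VSD : ℕ → ℕ → List ℤ → Set
VSD n k σ =
  SignedPerm n σ × σ ! 1 ≡ ℤ.- (+ k) ×
  (2 ℕ.≤ n → σ ! 2 ℤ.< + ∣ σ ! 1 ∣ × + 0 ℤ.< σ ! 2) ×
  All (λ i → 3 ℕ.≤ i → σ ! i ℤ.< + 0 → Valley (absList σ) (i ∸ 1)) (positions n)

neg : List ℤ → ℕ
neg σ = length (filter (ℤ._<? + 0) σ)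

valley? : ∀ w i → Dec (Valley w i)
valley? w i =
  (2 ℕ.≤? i ×-dec i + 1 ℕ.≤? length w ×-dec w ! i ℕ.<? w ! (i ∸ 1) ×-dec w ! i ℕ.<? w ! suc i)
  ⊎-dec (i ℕ.≟ 1 ×-dec 2 ℕ.≤? length w ×-dec w ! 1 ℕ.<? w ! 2)

signedPerm? : ∀ n σ → Dec (SignedPerm n σ)
signedPerm? n σ =
  length σ ℕ.≟ n
  ×-dec All.all? (λ x → 1 ℕ.≤? ∣ x ∣ ×-dec ∣ x ∣ ℕ.≤? n) σ
  ×-dec UDec.unique? ℕ._≟_ (absList σ)

vsb? : ∀ n k σ → Dec (VSB n k σ)
vsb? n k σ =
  signedPerm? n σ ×-dec σ ! 1 ℤ.≟ + k
  ×-dec All.all? (λ i → (σ ! i ℤ.<? + 0) →-dec (2 ℕ.≤? i ×-dec valley? (absList σ) (i ∸ 1))) (positions n)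

vsd? : ∀ n k σ → Dec (VSD n k σ)
vsd? n k σ =
  signedPerm? n σ ×-dec σ ! 1 ℤ.≟ ℤ.- (+ k)
  ×-dec ((2 ℕ.≤? n) →-dec (σ ! 2 ℤ.<? + ∣ σ ! 1 ∣ ×-dec + 0 ℤ.<? σ ! 2))
  ×-dec All.all? (λ i → (3 ℕ.≤? i) →-dec ((σ ! i ℤ.<? + 0) →-dec valley? (absList σ) (i ∸ 1))) (positions n)

letters : ℕ → List ℤ
letters n = map (λ j → + j) (positions n) ++ map (λ j → ℤ.- (+ j)) (positions n)

words : ℕ → ℕ → List (List ℤ)
words n zero = [] ∷ []
words n (suc L) = concatMap (λ x → map (x ∷_) (words n L)) (letters n)

-- the finite sets VS^(B)_{n,k}, VS^(D)_{n,k}, enumerated without repetition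
VSBset : ℕ → ℕ → List (List ℤ)
VSBset n k = filter (vsb? n k) (words n n)

VSDset : ℕ → ℕ → List (List ℤ)
VSDset n k = filter (vsd? n k) (words n n)

genPoly : ℕ → List (List ℤ) → LPoly
genPoly n S = sumᴸ (map (λ σ → mono (+ (n + 1) ℤ.- + (2 * neg σ))) S)

-- Let b_{n,j} and d_{n,j} be the generating polynomials of VS^(B)_{n,j} and VS^(D)_{n,j}.
-- Deleting the first letter ±j of σ and closing the gap at j in the remaining absolute values
-- leaves a signed permutation ρ of [n-1] with the same valley conditions from its second letter on,
-- and changes the exponent n+1-2·neg by ±1. For σ = (-j)ρ the conditions force ρ to start with a
-- positive letter a < j, and ρ is then an arbitrary element of VS^(B)_{n-1,a}, so
-- d_{n,j} = t⁻¹ Σ_{a<j} b_{n-1,a}. For σ = jρ, a first letter a of ρ contributes b_{n-1,a}; a first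
-- letter -a is allowed only for a ≥ j, and then ρ either lies in VS^(D)_{n-1,a} (next letter below a)
-- or becomes, after negating its first two letters, a word of VS^(B)_{n-1,a} with negative second
-- letter. Hence b_{n,j} = t (Σ_a b_{n-1,a} + Σ_{a≥j} d_{n-1,a}). These are the summed forms of the
-- Arnold–Hoffman recurrences under j = n-k+1, and the theorem follows by induction on n.

module Submission where

open import Defs
open import Data.Nat using (ℕ; _≤_; _+_; _∸_)
open import Data.Integer using (ℤ; +_; -_)
open import Data.Product using (_×_)
open import Relation.Binary.PropositionalEquality using (_≡_)

open import Data.Bool using (Bool; true; false; _∧_; not; if_then_else_)
open import Data.Bool.Properties using (¬-not)
open import Data.Integer as ℤ using (-[1+_]; ∣_∣)
import Data.Integer.Properties as ℤP
open import Data.List using (List; []; _∷_; map; length; filter; concatMap; upTo; applyUpTo; _++_)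
open import Data.List.Properties using (filter-accept; filter-reject; length-map)
open import Data.List.Relation.Unary.All as All using (All; []; _∷_)
import Data.List.Relation.Unary.All.Properties as AllP
open import Data.List.Relation.Unary.Any using (Any; here; there)
open import Data.List.Relation.Unary.Unique.Propositional using (Unique)
open import Data.List.Relation.Unary.AllPairs using (_∷_)
import Data.List.Relation.Unary.Unique.Propositional.Properties as UniqueP
open import Data.Nat as ℕ using (zero; suc; _*_; _<_; z≤n; s≤s)
import Data.Nat.Properties as ℕP
open import Data.Nat.Tactic.RingSolver using (solve-∀)
open import Data.Integer.Tactic.RingSolver renaming (solve-∀ to solveℤ)
open import Data.Product using (_,_; proj₁; proj₂; ∃-syntax)
open import Data.Sum using (inj₁; inj₂)
open import Data.Unit using (⊤; tt)
open import Function using (_∘_; _⇔_; mk⇔; Equivalence)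
open import Data.Product.Function.NonDependent.Propositional using (_×-⇔_)
open import Function.Related.TypeIsomorphisms using (→-cong-⇔)
open import Function.Properties.Equivalence using () renaming (refl to ⇔-refl; trans to ⇔-trans)
open import Relation.Binary.PropositionalEquality
  using (refl; sym; trans; cong; cong₂; subst; _≢_; _≗_; module ≡-Reasoning)
open import Relation.Binary.Definitions using (tri<; tri≈; tri>)
open import Relation.Nullary using (¬_; Dec; yes; no; does; contradiction)
open import Relation.Nullary.Decidable using (dec-false; does-⇔; _×-dec_; ¬?)
import Relation.Nullary.Decidable as Dec

private
  variable
    A B : Set

subst⇔ : (P : A → Set) {x y : A} → x ≡ y → P x ⇔ P y
subst⇔ P x≡y = mk⇔ (subst P x≡y) (subst P (sym x≡y))

proj₂-⇔ : {P Q : Set} → P → (P × Q) ⇔ Q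
proj₂-⇔ p = mk⇔ proj₂ (p ,_)

does⇒ : {P : Set} (P? : Dec P) → does P? ≡ true → P
does⇒ (yes p) _ = p

count : (A → Bool) → List A → ℕ
count p [] = 0
count p (x ∷ xs) = if p x then suc (count p xs) else count p xs

count-++ : (p : A → Bool) (xs ys : List A) → count p (xs ++ ys) ≡ count p xs + count p ys
count-++ p [] ys = refl
count-++ p (x ∷ xs) ys with p x
... | true = cong suc (count-++ p xs ys)
... | false = count-++ p xs ys

count-cong : {p q : A → Bool} → p ≗ q → count p ≗ count q
count-cong p≗q [] = refl
count-cong {q = q} p≗q (x ∷ xs) rewrite p≗q x with q x
... | true = cong suc (count-cong p≗q xs)
... | false = count-cong p≗q xs

count-≡0 : (p : A → Bool) → (∀ x → p x ≡ false) → ∀ xs → count p xs ≡ 0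
count-≡0 p p≡false [] = refl
count-≡0 p p≡false (x ∷ xs) rewrite p≡false x = count-≡0 p p≡false xs

count-∧-split : (p c : A → Bool) (xs : List A) →
  count p xs ≡ count (λ x → p x ∧ c x) xs + count (λ x → p x ∧ not (c x)) xs
count-∧-split p c [] = refl
count-∧-split p c (x ∷ xs) with p x | c x
... | false | _ = count-∧-split p c xs
... | true | true = cong suc (count-∧-split p c xs)
... | true | false = trans (cong suc (count-∧-split p c xs)) (sym (ℕP.+-suc _ _))

count-map : (p : B → Bool) (f : A → B) (xs : List A) → count p (map f xs) ≡ count (p ∘ f) xs
count-map p f [] = refl
count-map p f (x ∷ xs) with p (f x)
... | true = cong suc (count-map p f xs)
... | false = count-map p f xs

∑ : List A → (A → ℕ) → ℕ
∑ [] h = 0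
∑ (x ∷ xs) h = h x + ∑ xs h

∑-++ : (xs ys : List A) (h : A → ℕ) → ∑ (xs ++ ys) h ≡ ∑ xs h + ∑ ys h
∑-++ [] ys h = refl
∑-++ (x ∷ xs) ys h = trans (cong (_+_ (h x)) (∑-++ xs ys h)) (sym (ℕP.+-assoc (h x) _ _))

∑-cong : (xs : List A) {h g : A → ℕ} → h ≗ g → ∑ xs h ≡ ∑ xs g
∑-cong [] h≗g = refl
∑-cong (x ∷ xs) h≗g = cong₂ _+_ (h≗g x) (∑-cong xs h≗g)

∑-map : (f : A → B) (xs : List A) (h : B → ℕ) → ∑ (map f xs) h ≡ ∑ xs (h ∘ f)
∑-map f [] h = refl
∑-map f (x ∷ xs) h = cong (_+_ (h (f x))) (∑-map f xs h)

∑-≡0 : {xs : List A} (h : A → ℕ) → All (λ x → h x ≡ 0) xs → ∑ xs h ≡ 0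
∑-≡0 h [] = refl
∑-≡0 h (hx≡0 ∷ all≡0) rewrite hx≡0 = ∑-≡0 h all≡0

count-concatMap : (p : B → Bool) (f : A → List B) (xs : List A) →
  count p (concatMap f xs) ≡ ∑ xs (λ x → count p (f x))
count-concatMap p f [] = refl
count-concatMap p f (x ∷ xs) =
  trans (count-++ p (f x) (concatMap f xs)) (cong (_+_ (count p (f x))) (count-concatMap p f xs))

wordsOver : List A → ℕ → List (List A)
wordsOver as zero = [] ∷ []
wordsOver as (suc L) = concatMap (λ x → map (x ∷_) (wordsOver as L)) as

words≡wordsOver : ∀ n L → words n L ≡ wordsOver (letters n) L
words≡wordsOver n zero = refl
words≡wordsOver n (suc L) rewrite words≡wordsOver n L = refl

count-wordsOver-suc : (as : List A) (L : ℕ) (p : List A → Bool) →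
  count p (wordsOver as (suc L)) ≡ ∑ as (λ x → count (p ∘ (x ∷_)) (wordsOver as L))
count-wordsOver-suc as L p =
  trans (count-concatMap p _ as) (∑-cong as (λ x → count-map p (x ∷_) (wordsOver as L)))

count-words-suc : ∀ n L (p : List ℤ → Bool) →
  count p (words n (suc L)) ≡ ∑ (letters n) (λ x → count (p ∘ (x ∷_)) (words n L))
count-words-suc n L p =
  trans (count-concatMap p _ (letters n)) (∑-cong (letters n) (λ x → count-map p (x ∷_) (words n L)))

-- The alphabet bs consists, as far as sums are concerned, of the image of as under f and of
-- letters cs which the predicate never accepts.
count-wordsOver-reindex : (as : List A) (bs : List B) (f : A → B) (cs : List B) (Bad : B → Set) →
  All Bad cs → (∀ h → ∑ bs h ≡ ∑ as (h ∘ f) + ∑ cs h) →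
  ∀ L (p : List B → Bool) → (∀ w → Any Bad w → p w ≡ false) →
  count p (wordsOver bs L) ≡ count (p ∘ map f) (wordsOver as L)
count-wordsOver-reindex as bs f cs Bad allBad ∑bs zero p rejects = refl
count-wordsOver-reindex as bs f cs Bad allBad ∑bs (suc L) p rejects = begin
  count p (wordsOver bs (suc L))
    ≡⟨ count-wordsOver-suc bs L p ⟩
  ∑ bs (λ x → count (p ∘ (x ∷_)) (wordsOver bs L))
    ≡⟨ ∑bs _ ⟩
  ∑ as (λ y → count (p ∘ (f y ∷_)) (wordsOver bs L)) + ∑ cs (λ x → count (p ∘ (x ∷_)) (wordsOver bs L))
    ≡⟨ cong₂ _+_ (∑-cong as (λ y → reindexTail y)) (∑-≡0 _ (All.map badHead allBad)) ⟩
  ∑ as (λ y → count (p ∘ map f ∘ (y ∷_)) (wordsOver as L)) + 0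
    ≡⟨ ℕP.+-identityʳ _ ⟩
  ∑ as (λ y → count (p ∘ map f ∘ (y ∷_)) (wordsOver as L))
    ≡⟨ count-wordsOver-suc as L (p ∘ map f) ⟨
  count (p ∘ map f) (wordsOver as (suc L))
    ∎
  where
  open ≡-Reasoning
  reindexTail : ∀ y → count (p ∘ (f y ∷_)) (wordsOver bs L) ≡ count (p ∘ map f ∘ (y ∷_)) (wordsOver as L)
  reindexTail y = count-wordsOver-reindex as bs f cs Bad allBad ∑bs L (p ∘ (f y ∷_)) (λ w → rejects (f y ∷ w) ∘ there)
  badHead : ∀ {x} → Bad x → count (p ∘ (x ∷_)) (wordsOver bs L) ≡ 0
  badHead {x} bad = count-≡0 _ (λ w → rejects (x ∷ w) (here bad)) (wordsOver bs L)

sumFrom : ℕ → ℕ → (ℕ → ℕ) → ℕ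
sumFrom s zero g = 0
sumFrom s (suc m) g = g s + sumFrom (suc s) m g

sumFrom-suc : ∀ s m (g : ℕ → ℕ) → sumFrom (suc s) m g ≡ sumFrom s m (g ∘ suc)
sumFrom-suc s zero g = refl
sumFrom-suc s (suc m) g = cong (_+_ (g (suc s))) (sumFrom-suc (suc s) m g)

sumFrom-+ : ∀ s a b (g : ℕ → ℕ) → sumFrom s (a + b) g ≡ sumFrom s a g + sumFrom (s + a) b g
sumFrom-+ s zero b g = cong (λ t → sumFrom t b g) (sym (ℕP.+-identityʳ s))
sumFrom-+ s (suc a) b g = begin
  g s + sumFrom (suc s) (a + b) g
    ≡⟨ cong (_+_ (g s)) (sumFrom-+ (suc s) a b g) ⟩
  g s + (sumFrom (suc s) a g + sumFrom (suc s + a) b g)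
    ≡⟨ cong (λ t → g s + (sumFrom (suc s) a g + sumFrom t b g)) (sym (ℕP.+-suc s a)) ⟩
  g s + (sumFrom (suc s) a g + sumFrom (s + suc a) b g)
    ≡⟨ ℕP.+-assoc (g s) _ _ ⟨
  g s + sumFrom (suc s) a g + sumFrom (s + suc a) b g
    ∎
  where open ≡-Reasoning

sumFrom-last : ∀ m (g : ℕ → ℕ) → sumFrom 1 (suc m) g ≡ sumFrom 1 m g + g (suc m)
sumFrom-last m g = begin
  sumFrom 1 (suc m) g       ≡⟨ cong (λ t → sumFrom 1 t g) (ℕP.+-comm 1 m) ⟩
  sumFrom 1 (m + 1) g       ≡⟨ sumFrom-+ 1 m 1 g ⟩
  sumFrom 1 m g + (g (suc m) + 0) ≡⟨ cong (_+_ (sumFrom 1 m g)) (ℕP.+-identityʳ (g (suc m))) ⟩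
  sumFrom 1 m g + g (suc m) ∎
  where open ≡-Reasoning

sumFrom-cong : ∀ s m {g g' : ℕ → ℕ} → (∀ i → s ≤ i → i < s + m → g i ≡ g' i) → sumFrom s m g ≡ sumFrom s m g'
sumFrom-cong s zero g≡g' = refl
sumFrom-cong s (suc m) g≡g' =
  cong₂ _+_ (g≡g' s ℕP.≤-refl (ℕP.m<m+n s (s≤s z≤n)))
            (sumFrom-cong (suc s) m (λ i s<i i<s+1+m → g≡g' i (ℕP.<⇒≤ s<i) (subst (i <_) (sym (ℕP.+-suc s m)) i<s+1+m)))

sumFrom-≡0 : ∀ s m {g : ℕ → ℕ} → (∀ i → s ≤ i → i < s + m → g i ≡ 0) → sumFrom s m g ≡ 0
sumFrom-≡0 s zero g≡0 = refl
sumFrom-≡0 s (suc m) g≡0 =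
  cong₂ _+_ (g≡0 s ℕP.≤-refl (ℕP.m<m+n s (s≤s z≤n)))
            (sumFrom-≡0 (suc s) m (λ i s<i i<s+1+m → g≡0 i (ℕP.<⇒≤ s<i) (subst (i <_) (sym (ℕP.+-suc s m)) i<s+1+m)))

sumFrom-distrib : ∀ s m (f g : ℕ → ℕ) → sumFrom s m f + sumFrom s m g ≡ sumFrom s m (λ a → f a + g a)
sumFrom-distrib s zero f g = refl
sumFrom-distrib s (suc m) f g =
  trans (interchange (f s) (sumFrom (suc s) m f) (g s) (sumFrom (suc s) m g))
        (cong (_+_ (f s + g s)) (sumFrom-distrib (suc s) m f g))
  where
  interchange : ∀ a b c d → (a + b) + (c + d) ≡ (a + c) + (b + d)
  interchange = solve-∀

sumFrom-truncate : ∀ d M {g g' : ℕ → ℕ} → d ≤ M → (∀ a → 1 ≤ a → a ≤ d → g a ≡ g' a) → (∀ a → d < a → a ≤ M → g a ≡ 0) →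
  sumFrom 1 M g ≡ sumFrom 1 d g'
sumFrom-truncate d M {g} {g'} d≤M g≡g' g≡0 with ℕP.m≤n⇒∃[o]m+o≡n d≤M
... | r , refl = begin
  sumFrom 1 (d + r) g                  ≡⟨ sumFrom-+ 1 d r g ⟩
  sumFrom 1 d g + sumFrom (suc d) r g  ≡⟨ cong₂ _+_ (sumFrom-cong 1 d (λ a 1≤a a<1+d → g≡g' a 1≤a (ℕP.≤-pred a<1+d)))
                                                    (sumFrom-≡0 (suc d) r (λ a d<a a<1+d+r → g≡0 a d<a (ℕP.≤-pred a<1+d+r))) ⟩
  sumFrom 1 d g' + 0                   ≡⟨ ℕP.+-identityʳ _ ⟩
  sumFrom 1 d g'                       ∎
  where open ≡-Reasoning

restrictFrom : ℕ → (ℕ → ℕ) → ℕ → ℕ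
restrictFrom j g a with j ℕ.≤? a
... | yes _ = g a
... | no _ = 0

module _ {j : ℕ} (g : ℕ → ℕ) {a : ℕ} where

  restrictFrom-< : a < j → restrictFrom j g a ≡ 0
  restrictFrom-< a<j with j ℕ.≤? a
  ... | yes j≤a = contradiction j≤a (ℕP.<⇒≱ a<j)
  ... | no _ = refl

  restrictFrom-≥ : j ≤ a → restrictFrom j g a ≡ g a
  restrictFrom-≥ j≤a with j ℕ.≤? a
  ... | yes _ = refl
  ... | no j≰a = contradiction j≤a j≰a

sumFrom-restrictFrom : ∀ j m (g : ℕ → ℕ) → 1 ≤ j → j ≤ suc m → sumFrom 1 m (restrictFrom j g) ≡ sumFrom j (suc m ∸ j) g
sumFrom-restrictFrom (suc j′) m g _ (s≤s j′≤m) with ℕP.m≤n⇒∃[o]m+o≡n j′≤m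
... | r , refl = begin
  sumFrom 1 (j′ + r) (restrictFrom (suc j′) g)
    ≡⟨ sumFrom-+ 1 j′ r _ ⟩
  sumFrom 1 j′ (restrictFrom (suc j′) g) + sumFrom (suc j′) r (restrictFrom (suc j′) g)
    ≡⟨ cong₂ _+_ (sumFrom-≡0 1 j′ (λ a _ a<1+j′ → restrictFrom-< g a<1+j′))
                 (sumFrom-cong (suc j′) r (λ a 1+j′≤a _ → restrictFrom-≥ g 1+j′≤a)) ⟩
  sumFrom (suc j′) r g
    ≡⟨ cong (λ t → sumFrom (suc j′) t g) (ℕP.m+n∸m≡n j′ r) ⟨
  sumFrom (suc j′) (j′ + r ∸ j′) g
    ∎
  where open ≡-Reasoning

∑-applyUpTo : ∀ (f : ℕ → ℕ) n (g : ℕ → ℕ) → ∑ (applyUpTo f n) g ≡ sumFrom 0 n (g ∘ f)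
∑-applyUpTo f zero g = refl
∑-applyUpTo f (suc n) g =
  cong (_+_ (g (f 0))) (trans (∑-applyUpTo (f ∘ suc) n g) (sym (sumFrom-suc 0 n (g ∘ f))))

∑-positions : ∀ n (g : ℕ → ℕ) → ∑ (positions n) g ≡ sumFrom 1 n g
∑-positions n g = begin
  ∑ (positions n) g              ≡⟨ ∑-map suc (upTo n) g ⟩
  ∑ (upTo n) (g ∘ suc)           ≡⟨ ∑-applyUpTo (λ i → i) n (g ∘ suc) ⟩
  sumFrom 0 n (g ∘ suc)          ≡⟨ sumFrom-suc 0 n g ⟨
  sumFrom 1 n g                  ∎
  where open ≡-Reasoning

∑-letters : ∀ n (h : ℤ → ℕ) → ∑ (letters n) h ≡ sumFrom 1 n (λ a → h (+ a)) + sumFrom 1 n (λ a → h (- (+ a)))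
∑-letters n h = trans (∑-++ (map +_ (positions n)) _ h)
  (cong₂ _+_ (trans (∑-map +_ (positions n) h) (∑-positions n _))
             (trans (∑-map _ (positions n) h) (∑-positions n _)))

∑-letters-neg : ∀ n (h : ℤ → ℕ) → ∑ (letters n) h ≡ ∑ (letters n) (h ∘ -_)
∑-letters-neg n h = begin
  ∑ (letters n) h
    ≡⟨ ∑-letters n h ⟩
  sumFrom 1 n (λ a → h (+ a)) + sumFrom 1 n (λ a → h (- (+ a)))
    ≡⟨ ℕP.+-comm (sumFrom 1 n (λ a → h (+ a))) _ ⟩
  sumFrom 1 n (λ a → h (- (+ a))) + sumFrom 1 n (λ a → h (+ a))
    ≡⟨ cong (_+_ _) (sumFrom-cong 1 n (λ a _ _ → cong h (sym (ℤP.neg-involutive (+ a))))) ⟩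
  sumFrom 1 n (λ a → h (- (+ a))) + sumFrom 1 n (λ a → h (- - (+ a)))
    ≡⟨ ∑-letters n (h ∘ -_) ⟨
  ∑ (letters n) (h ∘ -_)
    ∎
  where open ≡-Reasoning

-- Standardisation: opening a gap at c

punchIn : ℕ → ℕ → ℕ
punchIn c a with a ℕ.<? c
... | yes _ = a
... | no _ = suc a

module _ {c a : ℕ} where

  punchIn-< : a < c → punchIn c a ≡ a
  punchIn-< a<c with a ℕ.<? c
  ... | yes _ = refl
  ... | no a≮c = contradiction a<c a≮c

  punchIn-≥ : c ≤ a → punchIn c a ≡ suc a
  punchIn-≥ c≤a with a ℕ.<? c
  ... | yes a<c = contradiction c≤a (ℕP.<⇒≱ a<c)
  ... | no _ = refl

punchIn-≢ : ∀ c a → punchIn c a ≢ c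
punchIn-≢ c a with a ℕ.<? c
... | yes a<c = ℕP.<⇒≢ a<c
... | no a≮c = λ 1+a≡c → a≮c (subst (a <_) 1+a≡c ℕP.≤-refl)

punchIn-mono-< : ∀ c {a b} → a < b → punchIn c a < punchIn c b
punchIn-mono-< c {a} {b} a<b with a ℕ.<? c | b ℕ.<? c
... | yes _ | yes _ = a<b
... | yes _ | no _ = ℕP.m<n⇒m<1+n a<b
... | no a≮c | yes b<c = contradiction (ℕP.<-trans a<b b<c) a≮c
... | no _ | no _ = s≤s a<b

punchIn-cancel-< : ∀ c {a b} → punchIn c a < punchIn c b → a < b
punchIn-cancel-< c {a} {b} pa<pb with ℕP.<-cmp a b
... | tri< a<b _ _ = a<b
... | tri≈ _ refl _ = contradiction pa<pb (ℕP.<-irrefl refl)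
... | tri> _ _ b<a = contradiction pa<pb (ℕP.<-asym (punchIn-mono-< c b<a))

punchIn-injective : ∀ c {a b} → punchIn c a ≡ punchIn c b → a ≡ b
punchIn-injective c {a} {b} pa≡pb with ℕP.<-cmp a b
... | tri< a<b _ _ = contradiction pa≡pb (ℕP.<⇒≢ (punchIn-mono-< c a<b))
... | tri≈ _ a≡b _ = a≡b
... | tri> _ _ b<a = contradiction (sym pa≡pb) (ℕP.<⇒≢ (punchIn-mono-< c b<a))

punchIn-<-⇔ : ∀ c {a b} → punchIn c a < punchIn c b ⇔ a < b
punchIn-<-⇔ c = mk⇔ (punchIn-cancel-< c) (punchIn-mono-< c)

punchIn-<-self⇔ : ∀ c b → punchIn c b < c ⇔ b < c
punchIn-<-self⇔ c b = mk⇔ to (λ b<c → subst (_< c) (sym (punchIn-< b<c)) b<c)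
  where
  to : punchIn c b < c → b < c
  to pb<c with b ℕ.<? c
  ... | yes b<c = b<c
  ... | no _ = ℕP.<-trans (ℕP.n<1+n b) pb<c

self-<-punchIn⇔ : ∀ c b → c < punchIn c b ⇔ c ≤ b
self-<-punchIn⇔ c b = mk⇔ to (λ c≤b → subst (c <_) (sym (punchIn-≥ c≤b)) (s≤s c≤b))
  where
  to : c < punchIn c b → c ≤ b
  to c<pb with b ℕ.<? c
  ... | yes b<c = contradiction (ℕP.<-trans c<pb b<c) (ℕP.<-irrefl refl)
  ... | no _ = ℕP.≤-pred c<pb

punchIn-suc : ∀ c a → ∃[ b ] punchIn c (suc a) ≡ suc b
punchIn-suc c a with suc a ℕ.<? c
... | yes _ = a , refl
... | no _ = suc a , refl

sumFrom-punchIn : ∀ c m (g : ℕ → ℕ) → 1 ≤ c → c ≤ suc m → sumFrom 1 (suc m) g ≡ sumFrom 1 m (g ∘ punchIn c) + g c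
sumFrom-punchIn (suc c) m g _ (s≤s c≤m) with ℕP.m≤n⇒∃[o]m+o≡n c≤m
... | r , refl = begin
  sumFrom 1 (suc (c + r)) g
    ≡⟨ cong (λ t → sumFrom 1 t g) (sym (ℕP.+-suc c r)) ⟩
  sumFrom 1 (c + suc r) g
    ≡⟨ sumFrom-+ 1 c (suc r) g ⟩
  sumFrom 1 c g + (g (suc c) + sumFrom (2 + c) r g)
    ≡⟨ swap (sumFrom 1 c g) (g (suc c)) (sumFrom (2 + c) r g) ⟩
  sumFrom 1 c g + sumFrom (2 + c) r g + g (suc c)
    ≡⟨ cong (_+ g (suc c)) (cong₂ _+_ below above) ⟨
  sumFrom 1 c (g ∘ punchIn (suc c)) + sumFrom (suc c) r (g ∘ punchIn (suc c)) + g (suc c)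
    ≡⟨ cong (_+ g (suc c)) (sumFrom-+ 1 c r (g ∘ punchIn (suc c))) ⟨
  sumFrom 1 (c + r) (g ∘ punchIn (suc c)) + g (suc c)
    ∎
  where
  open ≡-Reasoning
  swap : ∀ x y z → x + (y + z) ≡ (x + z) + y
  swap = solve-∀
  below : sumFrom 1 c (g ∘ punchIn (suc c)) ≡ sumFrom 1 c g
  below = sumFrom-cong 1 c (λ i _ i<1+c → cong g (punchIn-< i<1+c))
  above : sumFrom (suc c) r (g ∘ punchIn (suc c)) ≡ sumFrom (2 + c) r g
  above = trans (sumFrom-cong (suc c) r (λ i 1+c≤i _ → cong g (punchIn-≥ 1+c≤i))) (sym (sumFrom-suc (suc c) r g))

punchInℤ : ℕ → ℤ → ℤ
punchInℤ c (+ a) = + punchIn c a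
punchInℤ c -[1+ a ] = - (+ punchIn c (suc a))

∣punchInℤ∣ : ∀ c x → ∣ punchInℤ c x ∣ ≡ punchIn c ∣ x ∣
∣punchInℤ∣ c (+ a) = refl
∣punchInℤ∣ c -[1+ a ] = ℤP.∣-i∣≡∣i∣ (+ punchIn c (suc a))

punchInℤ-<0 : ∀ c x → punchInℤ c x ℤ.< + 0 ⇔ x ℤ.< + 0
punchInℤ-<0 c (+ a) = mk⇔ (λ { (ℤ.+<+ ()) }) (λ { (ℤ.+<+ ()) })
punchInℤ-<0 c -[1+ a ] rewrite proj₂ (punchIn-suc c a) = mk⇔ (λ _ → ℤ.-<+) (λ _ → ℤ.-<+)

absList-punchIn : ∀ c ρ → absList (map (punchInℤ c) ρ) ≡ map (punchIn c) (absList ρ)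
absList-punchIn c [] = refl
absList-punchIn c (x ∷ ρ) = cong₂ _∷_ (∣punchInℤ∣ c x) (absList-punchIn c ρ)

∑-letters-punchIn : ∀ c m (h : ℤ → ℕ) → 1 ≤ c → c ≤ suc m →
  ∑ (letters (suc m)) h ≡ ∑ (letters m) (h ∘ punchInℤ c) + ∑ (+ c ∷ - (+ c) ∷ []) h
∑-letters-punchIn c m h 1≤c c≤1+m = begin
  ∑ (letters (suc m)) h
    ≡⟨ ∑-letters (suc m) h ⟩
  sumFrom 1 (suc m) hPos + sumFrom 1 (suc m) hNeg
    ≡⟨ cong₂ _+_ (sumFrom-punchIn c m hPos 1≤c c≤1+m) (sumFrom-punchIn c m hNeg 1≤c c≤1+m) ⟩
  (sumFrom 1 m (hPos ∘ punchIn c) + hPos c) + (sumFrom 1 m (hNeg ∘ punchIn c) + hNeg c)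
    ≡⟨ interchange (sumFrom 1 m (hPos ∘ punchIn c)) (hPos c) (sumFrom 1 m (hNeg ∘ punchIn c)) (hNeg c) ⟩
  (sumFrom 1 m (hPos ∘ punchIn c) + sumFrom 1 m (hNeg ∘ punchIn c)) + (hPos c + (hNeg c + 0))
    ≡⟨ cong (λ s → (sumFrom 1 m (hPos ∘ punchIn c) + s) + (hPos c + (hNeg c + 0)))
         (sumFrom-cong 1 m λ { (suc i) _ _ → refl }) ⟩
  (sumFrom 1 m (λ a → h (punchInℤ c (+ a))) + sumFrom 1 m (λ a → h (punchInℤ c (- (+ a))))) + (hPos c + (hNeg c + 0))
    ≡⟨ cong (_+ (hPos c + (hNeg c + 0))) (∑-letters m (h ∘ punchInℤ c)) ⟨
  ∑ (letters m) (h ∘ punchInℤ c) + ∑ (+ c ∷ - (+ c) ∷ []) h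
    ∎
  where
  open ≡-Reasoning
  hPos hNeg : ℕ → ℕ
  hPos a = h (+ a)
  hNeg a = h (- (+ a))
  interchange : ∀ a b c d → (a + b) + (c + d) ≡ (a + c) + (b + (d + 0))
  interchange = solve-∀

∑-±-single : ∀ (h : ℤ → ℕ) x₀ → 1 ≤ ∣ x₀ ∣ → (∀ x → x ≢ x₀ → h x ≡ 0) →
  ∑ (+ ∣ x₀ ∣ ∷ - (+ ∣ x₀ ∣) ∷ []) h ≡ h x₀
∑-±-single h (+ suc a) _ h≡0 rewrite h≡0 -[1+ a ] (λ ()) = ℕP.+-identityʳ _
∑-±-single h -[1+ a ] _ h≡0 rewrite h≡0 (+ suc a) (λ ()) = ℕP.+-identityʳ _

module _ (m : ℕ) {c : ℕ} (1≤c : 1 ≤ c) (c≤1+m : c ≤ suc m) where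

  count-words-forcedHead : ∀ L (p : List ℤ → Bool) x₀ → ∣ x₀ ∣ ≡ c → (∀ x w → p (x ∷ w) ≡ true → x ≡ x₀) →
    count p (words (suc m) (suc L)) ≡ count (p ∘ (x₀ ∷_)) (words (suc m) L)
  count-words-forcedHead L p x₀ refl forced = begin
    count p (words (suc m) (suc L))
      ≡⟨ count-words-suc (suc m) L p ⟩
    ∑ (letters (suc m)) H
      ≡⟨ ∑-letters-punchIn c m H 1≤c c≤1+m ⟩
    ∑ (letters m) (H ∘ punchInℤ c) + ∑ (+ c ∷ - (+ c) ∷ []) H
      ≡⟨ cong₂ _+_ (∑-≡0 _ (All.universal (λ y → H≡0 (punchInℤ c y) (punchIn≢x₀ y)) (letters m)))
                   (∑-±-single H x₀ 1≤c H≡0) ⟩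
    H x₀
      ∎
    where
    open ≡-Reasoning
    H : ℤ → ℕ
    H x = count (p ∘ (x ∷_)) (words (suc m) L)
    H≡0 : ∀ x → x ≢ x₀ → H x ≡ 0
    H≡0 x x≢x₀ = count-≡0 _ (λ w → ¬-not (x≢x₀ ∘ forced x w)) (words (suc m) L)
    punchIn≢x₀ : ∀ y → punchInℤ c y ≢ x₀
    punchIn≢x₀ y eq = punchIn-≢ c ∣ y ∣ (trans (sym (∣punchInℤ∣ c y)) (cong ∣_∣ eq))

  count-words-punchIn : ∀ L (p : List ℤ → Bool) → (∀ w → Any (λ y → ∣ y ∣ ≡ c) w → p w ≡ false) →
    count p (words (suc m) L) ≡ count (p ∘ map (punchInℤ c)) (words m L)
  count-words-punchIn L p rejects = begin
    count p (words (suc m) L)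
      ≡⟨ cong (count p) (words≡wordsOver (suc m) L) ⟩
    count p (wordsOver (letters (suc m)) L)
      ≡⟨ count-wordsOver-reindex (letters m) (letters (suc m)) (punchInℤ c) (+ c ∷ - (+ c) ∷ [])
           (λ y → ∣ y ∣ ≡ c) (refl ∷ ℤP.∣-i∣≡∣i∣ (+ c) ∷ [])
           (λ h → ∑-letters-punchIn c m h 1≤c c≤1+m) L p rejects ⟩
    count (p ∘ map (punchInℤ c)) (wordsOver (letters m) L)
      ≡⟨ cong (count (p ∘ map (punchInℤ c))) (words≡wordsOver m L) ⟨
    count (p ∘ map (punchInℤ c)) (words m L)
      ∎
    where open ≡-Reasoning

negateHead : List ℤ → List ℤ
negateHead [] = []
negateHead (x ∷ w) = - x ∷ w

count-words-negateHead : ∀ n L (p : List ℤ → Bool) → count p (words n L) ≡ count (p ∘ negateHead) (words n L)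
count-words-negateHead n zero p = refl
count-words-negateHead n (suc L) p =
  trans (count-words-suc n L p)
        (trans (∑-letters-neg n _) (sym (count-words-suc n L (p ∘ negateHead))))

count-words-byHeadSign : ∀ m L (p : List ℤ → Bool) → count p (words m (suc L)) ≡
  sumFrom 1 m (λ a → count (p ∘ (+ a ∷_)) (words m L)) + sumFrom 1 m (λ a → count (p ∘ (- (+ a) ∷_)) (words m L))
count-words-byHeadSign m L p = trans (count-words-suc m L p) (∑-letters m _)

¬+<0 : ∀ a → ¬ (+ a ℤ.< + 0)
¬+<0 a (ℤ.+<+ ())

-+<0 : ∀ {j} → 1 ≤ j → - (+ j) ℤ.< + 0
-+<0 (s≤s z≤n) = ℤ.-<+

neg-∷-< : ∀ {x} ρ → x ℤ.< + 0 → neg (x ∷ ρ) ≡ suc (neg ρ)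
neg-∷-< ρ x<0 = cong length (filter-accept (ℤ._<? + 0) x<0)

neg-∷-≮ : ∀ {x} ρ → ¬ (x ℤ.< + 0) → neg (x ∷ ρ) ≡ neg ρ
neg-∷-≮ ρ x≮0 = cong length (filter-reject (ℤ._<? + 0) x≮0)

neg-map : (f : ℤ → ℤ) → (∀ x → f x ℤ.< + 0 ⇔ x ℤ.< + 0) → ∀ ρ → neg (map f ρ) ≡ neg ρ
neg-map f sign [] = refl
neg-map f sign (x ∷ ρ) = bySign (x ℤ.<? + 0)
  where
  bySign : Dec (x ℤ.< + 0) → neg (map f (x ∷ ρ)) ≡ neg (x ∷ ρ)
  bySign (yes x<0) = trans (neg-∷-< (map f ρ) (Equivalence.from (sign x) x<0))
                           (trans (cong suc (neg-map f sign ρ)) (sym (neg-∷-< ρ x<0)))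
  bySign (no x≮0) = trans (neg-∷-≮ (map f ρ) (x≮0 ∘ Equivalence.to (sign x)))
                          (trans (neg-map f sign ρ) (sym (neg-∷-≮ ρ x≮0)))

deg : ℕ → List ℤ → ℤ
deg n σ = + (n + 1) ℤ.- + (2 * neg σ)

deg-∷-≮ : ∀ m σ ρ → neg σ ≡ neg ρ → deg (suc m) σ ≡ deg m ρ ℤ.+ + 1
deg-∷-≮ m σ ρ negσ≡negρ rewrite negσ≡negρ = shuffle (+ (m + 1)) (+ (2 * neg ρ))
  where
  shuffle : ∀ (a k : ℤ) → (+ 1 ℤ.+ a) ℤ.- k ≡ (a ℤ.- k) ℤ.+ + 1
  shuffle = solveℤ

deg-∷-< : ∀ m σ ρ → neg σ ≡ suc (neg ρ) → deg (suc m) σ ≡ deg m ρ ℤ.+ - (+ 1)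
deg-∷-< m σ ρ negσ≡1+negρ =
  trans (cong (λ k → + (suc m + 1) ℤ.- + k) (trans (cong (2 *_) negσ≡1+negρ) (ℕP.*-suc 2 (neg ρ))))
        (shuffle (+ (m + 1)) (+ (2 * neg ρ)))
  where
  shuffle : ∀ (a k : ℤ) → (+ 1 ℤ.+ a) ℤ.- (+ 2 ℤ.+ k) ≡ (a ℤ.- k) ℤ.+ - (+ 1)
  shuffle = solveℤ

≡-+⇔-≡ : ∀ e x d → e ≡ x ℤ.+ d ⇔ e ℤ.- d ≡ x
≡-+⇔-≡ e x d = mk⇔ (λ { refl → cancel x d }) (λ { refl → sym (uncancel e d) })
  where
  cancel : ∀ (x d : ℤ) → (x ℤ.+ d) ℤ.- d ≡ x
  cancel = solveℤ
  uncancel : ∀ (e d : ℤ) → (e ℤ.- d) ℤ.+ d ≡ e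
  uncancel = solveℤ

length-absList : ∀ σ → length (absList σ) ≡ length σ
length-absList = length-map ∣_∣

signedPerm-absList : ∀ {n σ σ′} → absList σ ≡ absList σ′ → SignedPerm n σ → SignedPerm n σ′
signedPerm-absList {n} {σ} {σ′} eq (len , inRange , unique) =
  trans (sym (length-absList σ′)) (trans (cong length (sym eq)) (trans (length-absList σ) len)) ,
  AllP.map⁻ (subst (All (λ a → 1 ≤ a × a ≤ n)) eq (AllP.map⁺ inRange)) ,
  subst Unique eq unique

module _ {m c : ℕ} (1≤c : 1 ≤ c) (c≤1+m : c ≤ suc m) where

  inRange-punchIn : ∀ y → (1 ≤ ∣ punchInℤ c y ∣ × ∣ punchInℤ c y ∣ ≤ suc m) ⇔ (1 ≤ ∣ y ∣ × ∣ y ∣ ≤ m)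
  inRange-punchIn y rewrite ∣punchInℤ∣ c y with ∣ y ∣ ℕ.<? c
  ... | yes a<c =
    mk⇔ (λ (1≤a , _) → 1≤a , ℕP.≤-pred (ℕP.≤-trans a<c c≤1+m)) (λ (1≤a , a≤m) → 1≤a , ℕP.m≤n⇒m≤1+n a≤m)
  ... | no a≮c =
    mk⇔ (λ { (_ , s≤s a≤m) → ℕP.≤-trans 1≤c (ℕP.≮⇒≥ a≮c) , a≤m }) (λ (_ , a≤m) → s≤s z≤n , s≤s a≤m)

  signedPerm-punchIn : ∀ {x} ρ → ∣ x ∣ ≡ c → SignedPerm (suc m) (x ∷ map (punchInℤ c) ρ) ⇔ SignedPerm m ρ
  signedPerm-punchIn {x} ρ refl = mk⇔
    (λ { (len , _ ∷ inRange , _ ∷ unique) →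
       trans (sym (length-map (punchInℤ c) ρ)) (ℕP.suc-injective len) ,
       All.map (λ {y} → Equivalence.to (inRange-punchIn y)) (AllP.map⁻ inRange) ,
       UniqueP.map⁻ (subst Unique (absList-punchIn c ρ) unique) })
    (λ (len , inRange , unique) →
       cong suc (trans (length-map (punchInℤ c) ρ) len) ,
       (1≤c , c≤1+m) ∷ AllP.map⁺ (All.map (λ {y} → Equivalence.from (inRange-punchIn y)) inRange) ,
       subst (All (c ≢_)) (sym (absList-punchIn c ρ))
             (AllP.map⁺ (All.universal (λ a → punchIn-≢ c a ∘ sym) (absList ρ))) ∷
       subst Unique (sym (absList-punchIn c ρ)) (UniqueP.map⁺ (punchIn-injective c) unique))

signedPerm-head∉tail : ∀ {n x w} → SignedPerm n (x ∷ w) → ¬ Any (λ y → ∣ y ∣ ≡ ∣ x ∣) w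
signedPerm-head∉tail (_ , _ , x∉w ∷ _) y∈w = let (x≢y , y≡x) = All.lookupAny (AllP.map⁻ x∉w) y∈w in x≢y (sym y≡x)

-- Valley conditions read along the word

valley-interior : ∀ w {p} → Valley w (2 + p) →
  (2 + p) + 1 ≤ length w × w ! (2 + p) < w ! (1 + p) × w ! (2 + p) < w ! (3 + p)
valley-interior w (inj₁ (_ , v)) = v
valley-interior w (inj₂ (() , _))

valley-∷ : ∀ a w p → Valley (a ∷ w) (3 + p) ⇔ Valley w (2 + p)
valley-∷ a w p = mk⇔ to from
  where
  to : Valley (a ∷ w) (3 + p) → Valley w (2 + p)
  to v with valley-interior (a ∷ w) v
  ... | s≤s len , w₁ , w₂ = inj₁ (s≤s (s≤s z≤n) , len , w₁ , w₂)
  from : Valley w (2 + p) → Valley (a ∷ w) (3 + p)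
  from v with valley-interior w v
  ... | len , w₁ , w₂ = inj₁ (s≤s (s≤s z≤n) , s≤s len , w₁ , w₂)

-- a and b are the absolute values of the two letters preceding the list.
ValleyTail : ℕ → ℕ → List ℤ → Set
ValleyTail a b [] = ⊤
ValleyTail a b (x ∷ r) = (x ℤ.< + 0 → b < a × b < ∣ x ∣) × ValleyTail b ∣ x ∣ r

NegativesFromThirdFollowValleys : List ℤ → Set
NegativesFromThirdFollowValleys σ = ∀ i → 3 ≤ i → i ≤ length σ → σ ! i ℤ.< + 0 → Valley (absList σ) (i ∸ 1)

negativesFollowValleys⇔ValleyTail : ∀ x y r →
  NegativesFromThirdFollowValleys (x ∷ y ∷ r) ⇔ ValleyTail ∣ x ∣ ∣ y ∣ r
negativesFollowValleys⇔ValleyTail x y r = mk⇔ (to x y r) (from x y r)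
  where
  to : ∀ x y r → NegativesFromThirdFollowValleys (x ∷ y ∷ r) → ValleyTail ∣ x ∣ ∣ y ∣ r
  to x y [] _ = tt
  to x y (z ∷ r) nfv = atThird , to y z r dropFirst
    where
    atThird : z ℤ.< + 0 → ∣ y ∣ < ∣ x ∣ × ∣ y ∣ < ∣ z ∣
    atThird z<0 = proj₂ (valley-interior (absList (x ∷ y ∷ z ∷ r)) (nfv 3 ℕP.≤-refl (s≤s (s≤s (s≤s z≤n))) z<0))
    dropFirst : NegativesFromThirdFollowValleys (y ∷ z ∷ r)
    dropFirst 1 (s≤s ())
    dropFirst 2 (s≤s (s≤s ()))
    dropFirst (suc (suc (suc i))) _ i≤ neg =
      Equivalence.to (valley-∷ ∣ x ∣ _ i) (nfv (4 + i) (s≤s (s≤s (s≤s z≤n))) (s≤s i≤) neg)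
  from : ∀ x y r → ValleyTail ∣ x ∣ ∣ y ∣ r → NegativesFromThirdFollowValleys (x ∷ y ∷ r)
  from x y r _ 1 (s≤s ())
  from x y r _ 2 (s≤s (s≤s ()))
  from x y (z ∷ r) (atThird , _) 3 _ _ z<0 =
    inj₁ (s≤s (s≤s z≤n) , s≤s (s≤s (s≤s z≤n)) , atThird z<0)
  from x y (z ∷ r) (_ , vt) (suc (suc (suc (suc i)))) _ (s≤s i≤) neg =
    Equivalence.from (valley-∷ ∣ x ∣ _ i) (from y z r vt (3 + i) (s≤s (s≤s (s≤s z≤n))) i≤ neg)
  from x y [] _ (suc (suc (suc i))) _ (s≤s (s≤s ()))

IsVSB : List ℤ → Set
IsVSB [] = ⊤
IsVSB (x ∷ []) = ⊤
IsVSB (x ∷ y ∷ r) = (y ℤ.< + 0 → ∣ x ∣ < ∣ y ∣) × ValleyTail ∣ x ∣ ∣ y ∣ r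

IsVSD : List ℤ → Set
IsVSD [] = ⊤
IsVSD (x ∷ []) = ⊤
IsVSD (x ∷ y ∷ r) = (y ℤ.< + ∣ x ∣ × + 0 ℤ.< y) × ValleyTail ∣ x ∣ ∣ y ∣ r

All-positions⇔ : ∀ {P : ℕ → Set} n → All P (positions n) ⇔ (∀ i → 1 ≤ i → i ≤ n → P i)
All-positions⇔ n = mk⇔
  (λ all → λ { (suc i) _ i<n → AllP.applyUpTo⁻ (λ i → i) n (AllP.map⁻ all) i<n })
  (λ P → AllP.map⁺ (AllP.applyUpTo⁺₁ (λ i → i) n (λ {i} i<n → P (suc i) (s≤s z≤n) i<n)))

vsbValleys⇔IsVSB : ∀ {k} σ → σ ! 1 ≡ + k →
  All (λ i → σ ! i ℤ.< + 0 → 2 ≤ i × Valley (absList σ) (i ∸ 1)) (positions (length σ)) ⇔ IsVSB σ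
vsbValleys⇔IsVSB [] _ = mk⇔ (λ _ → tt) (λ _ → [])
vsbValleys⇔IsVSB {k} (x ∷ []) refl =
  mk⇔ (λ _ → tt) (λ _ → Equivalence.from (All-positions⇔ 1) λ where
    1 _ _ x<0 → contradiction x<0 (¬+<0 k)
    (suc (suc _)) _ (s≤s ()))
vsbValleys⇔IsVSB {k} (x ∷ y ∷ r) refl = mk⇔ to from
  where
  σ = x ∷ y ∷ r
  to : _ → IsVSB σ
  to all = atSecond , Equivalence.to (negativesFollowValleys⇔ValleyTail x y r)
                        (λ i 3≤i i≤ neg → proj₂ (get i (ℕP.≤-trans (s≤s z≤n) 3≤i) i≤ neg))
    where
    get : ∀ i → 1 ≤ i → i ≤ length σ → σ ! i ℤ.< + 0 → 2 ≤ i × Valley (absList σ) (i ∸ 1)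
    get = Equivalence.to (All-positions⇔ (length σ)) all
    atSecond : y ℤ.< + 0 → ∣ x ∣ < ∣ y ∣
    atSecond y<0 with get 2 (s≤s z≤n) (s≤s (s≤s z≤n)) y<0
    ... | _ , inj₁ (s≤s () , _)
    ... | _ , inj₂ (_ , _ , x<y) = x<y
  from : IsVSB σ → _
  from (atSecond , vt) = Equivalence.from (All-positions⇔ (length σ)) λ where
    1 _ _ x<0 → contradiction x<0 (¬+<0 k)
    2 _ _ y<0 → s≤s (s≤s z≤n) , inj₂ (refl , s≤s (s≤s z≤n) , atSecond y<0)
    (suc (suc (suc i))) _ i≤ neg → s≤s (s≤s z≤n) ,
      Equivalence.from (negativesFollowValleys⇔ValleyTail x y r) vt (3 + i) (s≤s (s≤s (s≤s z≤n))) i≤ neg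

vsdValleys⇔IsVSD : ∀ σ → ((2 ≤ length σ → σ ! 2 ℤ.< + ∣ σ ! 1 ∣ × + 0 ℤ.< σ ! 2) ×
  All (λ i → 3 ≤ i → σ ! i ℤ.< + 0 → Valley (absList σ) (i ∸ 1)) (positions (length σ))) ⇔ IsVSD σ
vsdValleys⇔IsVSD [] = mk⇔ (λ _ → tt) (λ _ → (λ ()) , [])
vsdValleys⇔IsVSD (x ∷ []) = mk⇔ (λ _ → tt) (λ _ → (λ { (s≤s ()) }) , (λ { (s≤s ()) }) ∷ [])
vsdValleys⇔IsVSD (x ∷ y ∷ r) = mk⇔
  (λ (second , all) → second (s≤s (s≤s z≤n)) ,
     Equivalence.to (negativesFollowValleys⇔ValleyTail x y r)
       (λ i 3≤i i≤ → Equivalence.to (All-positions⇔ (length (x ∷ y ∷ r))) all i (ℕP.≤-trans (s≤s z≤n) 3≤i) i≤ 3≤i))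
  (λ (second , vt) → (λ _ → second) ,
     Equivalence.from (All-positions⇔ (length (x ∷ y ∷ r)))
       (λ i _ i≤ 3≤i → Equivalence.from (negativesFollowValleys⇔ValleyTail x y r) vt i 3≤i i≤))

ValleyTail-punchIn : ∀ c {a a'} b r → (punchIn c b < a' ⇔ b < a) →
  ValleyTail a' (punchIn c b) (map (punchInℤ c) r) ⇔ ValleyTail a b r
ValleyTail-punchIn c b [] _ = mk⇔ (λ _ → tt) (λ _ → tt)
ValleyTail-punchIn c b (z ∷ r) below⇔ =
  →-cong-⇔ (punchInℤ-<0 c z) (below⇔ ×-⇔ ⇔-trans (subst⇔ (punchIn c b <_) (∣punchInℤ∣ c z)) (punchIn-<-⇔ c))
    ×-⇔ ⇔-trans (subst⇔ (λ q → ValleyTail (punchIn c b) q (map (punchInℤ c) r)) (∣punchInℤ∣ c z))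
               (ValleyTail-punchIn c ∣ z ∣ r (punchIn-<-⇔ c))

ValleyTail⇔IsVSB-below : ∀ {c} x r → ∣ x ∣ < c → ValleyTail c ∣ x ∣ r ⇔ IsVSB (x ∷ r)
ValleyTail⇔IsVSB-below x [] _ = mk⇔ (λ _ → tt) (λ _ → tt)
ValleyTail⇔IsVSB-below x (z ∷ r) x<c =
  mk⇔ (λ (atZ , vt) → proj₂ ∘ atZ , vt) (λ (atZ , vt) → (λ z<0 → x<c , atZ z<0) , vt)

ValleyTail⇔IsVSB-above : ∀ {c} x r → c ≤ ∣ x ∣ → ValleyTail c ∣ x ∣ r ⇔ (IsVSB (x ∷ r) × ¬ (r ! 1 ℤ.< + 0))
ValleyTail⇔IsVSB-above x [] _ = mk⇔ (λ _ → tt , ¬+<0 0) (λ _ → tt)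
ValleyTail⇔IsVSB-above x (z ∷ r) c≤x =
  mk⇔ (λ (atZ , vt) → (proj₂ ∘ atZ , vt) , λ z<0 → ℕP.<⇒≱ (proj₁ (atZ z<0)) c≤x)
      (λ ((_ , vt) , z≮0) → (λ z<0 → contradiction z<0 z≮0) , vt)

IsVSB-punchIn : ∀ j x τ → IsVSB (+ j ∷ map (punchInℤ j) (x ∷ τ)) ⇔ ((x ℤ.< + 0 → j ≤ ∣ x ∣) × ValleyTail j ∣ x ∣ τ)
IsVSB-punchIn j x τ =
  →-cong-⇔ (punchInℤ-<0 j x) (⇔-trans (subst⇔ (j <_) (∣punchInℤ∣ j x)) (self-<-punchIn⇔ j ∣ x ∣))
  ×-⇔ ⇔-trans (subst⇔ (λ q → ValleyTail j q (map (punchInℤ j) τ)) (∣punchInℤ∣ j x))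
              (ValleyTail-punchIn j ∣ x ∣ τ (punchIn-<-self⇔ j ∣ x ∣))

IsVSD-punchIn : ∀ j x τ → IsVSD (- (+ j) ∷ map (punchInℤ j) (x ∷ τ)) ⇔
  ((punchInℤ j x ℤ.< + j × + 0 ℤ.< punchInℤ j x) × ValleyTail j ∣ punchInℤ j x ∣ (map (punchInℤ j) τ))
IsVSD-punchIn j x τ =
  subst⇔ (λ q → (punchInℤ j x ℤ.< + q × + 0 ℤ.< punchInℤ j x) × ValleyTail q ∣ punchInℤ j x ∣ (map (punchInℤ j) τ))
         (ℤP.∣-i∣≡∣i∣ (+ j))

module _ {j : ℕ} (τ : List ℤ) where

  IsVSD-punchIn-pos< : ∀ {a} → a < j → IsVSD (- (+ j) ∷ map (punchInℤ j) (+ a ∷ τ)) ⇔ (1 ≤ a × IsVSB (+ a ∷ τ))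
  IsVSD-punchIn-pos< {a} a<j = ⇔-trans (IsVSD-punchIn j (+ a) τ) (mk⇔
    (λ ((_ , 0<pa) , vt) → subst (1 ≤_) pa≡a (ℤP.drop‿+<+ 0<pa) , Equivalence.to vtLow vt)
    (λ (1≤a , isVSB) → (ℤ.+<+ (subst (_< j) (sym pa≡a) a<j) , ℤ.+<+ (subst (1 ≤_) (sym pa≡a) 1≤a)) ,
                       Equivalence.from vtLow isVSB))
    where
    pa≡a : punchIn j a ≡ a
    pa≡a = punchIn-< a<j
    vtLow : ValleyTail j (punchIn j a) (map (punchInℤ j) τ) ⇔ IsVSB (+ a ∷ τ)
    vtLow = ⇔-trans (ValleyTail-punchIn j a τ (punchIn-<-self⇔ j a)) (ValleyTail⇔IsVSB-below (+ a) τ a<j)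

  ¬IsVSD-punchIn-pos≥ : ∀ {a} → j ≤ a → ¬ IsVSD (- (+ j) ∷ map (punchInℤ j) (+ a ∷ τ))
  ¬IsVSD-punchIn-pos≥ {a} j≤a isVSD =
    ℕP.<-asym (ℤP.drop‿+<+ (proj₁ (proj₁ (Equivalence.to (IsVSD-punchIn j (+ a) τ) isVSD))))
              (Equivalence.from (self-<-punchIn⇔ j a) j≤a)

  ¬IsVSD-punchIn-neg : ∀ {a} → ¬ IsVSD (- (+ j) ∷ map (punchInℤ j) (-[1+ a ] ∷ τ))
  ¬IsVSD-punchIn-neg {a} isVSD =
    ℤP.<-asym (proj₂ (proj₁ (Equivalence.to (IsVSD-punchIn j -[1+ a ] τ) isVSD)))
              (Equivalence.from (punchInℤ-<0 j -[1+ a ]) ℤ.-<+)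

  IsVSB-punchIn-pos< : ∀ {a} → a < j → IsVSB (+ j ∷ map (punchInℤ j) (+ a ∷ τ)) ⇔ IsVSB (+ a ∷ τ)
  IsVSB-punchIn-pos< {a} a<j =
    ⇔-trans (IsVSB-punchIn j (+ a) τ)
      (⇔-trans (proj₂-⇔ (λ a<0 → contradiction a<0 (¬+<0 a))) (ValleyTail⇔IsVSB-below (+ a) τ a<j))

  IsVSB-punchIn-pos≥ : ∀ {a} → j ≤ a →
    IsVSB (+ j ∷ map (punchInℤ j) (+ a ∷ τ)) ⇔ (IsVSB (+ a ∷ τ) × ¬ (τ ! 1 ℤ.< + 0))
  IsVSB-punchIn-pos≥ {a} j≤a =
    ⇔-trans (IsVSB-punchIn j (+ a) τ)
      (⇔-trans (proj₂-⇔ (λ a<0 → contradiction a<0 (¬+<0 a))) (ValleyTail⇔IsVSB-above (+ a) τ j≤a))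

  ¬IsVSB-punchIn-neg< : ∀ {a} → suc a < j → ¬ IsVSB (+ j ∷ map (punchInℤ j) (-[1+ a ] ∷ τ))
  ¬IsVSB-punchIn-neg< a<j isVSB =
    ℕP.<⇒≱ a<j (proj₁ (Equivalence.to (IsVSB-punchIn j _ τ) isVSB) ℤ.-<+)

  IsVSB-punchIn-neg≥ : ∀ {a} → j ≤ suc a →
    IsVSB (+ j ∷ map (punchInℤ j) (-[1+ a ] ∷ τ)) ⇔ (IsVSB (-[1+ a ] ∷ τ) × ¬ (τ ! 1 ℤ.< + 0))
  IsVSB-punchIn-neg≥ j≤a =
    ⇔-trans (IsVSB-punchIn j _ τ)
      (⇔-trans (proj₂-⇔ (λ _ → j≤a)) (ValleyTail⇔IsVSB-above _ τ j≤a))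

IsVSB⇔IsVSD-descent : ∀ {m} a τ → SignedPerm m (-[1+ a ] ∷ τ) →
  ((IsVSB (-[1+ a ] ∷ τ) × ¬ (τ ! 1 ℤ.< + 0)) × ¬ (+ suc a ℤ.< τ ! 1)) ⇔ IsVSD (-[1+ a ] ∷ τ)
IsVSB⇔IsVSD-descent a [] _ = mk⇔ (λ _ → tt) (λ _ → (tt , ¬+<0 0) , ¬+<0 (suc a))
IsVSB⇔IsVSD-descent a (z ∷ τ) (_ , _ ∷ (1≤z , _) ∷ _ , (a≢z ∷ _) ∷ _) = mk⇔
  (λ (((_ , vt) , z≮0) , a≮z) → belowHead z z≮0 a≮z a≢z 1≤z , vt)
  (λ ((z<a , 0<z) , vt) → (((λ z<0 → contradiction 0<z (ℤP.<-asym z<0)) , vt) , ℤP.<-asym 0<z) , ℤP.<-asym z<a)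
  where
  belowHead : ∀ z → ¬ (z ℤ.< + 0) → ¬ (+ suc a ℤ.< z) → suc a ≢ ∣ z ∣ → 1 ≤ ∣ z ∣ → z ℤ.< + suc a × + 0 ℤ.< z
  belowHead -[1+ _ ] z≮0 _ _ _ = contradiction ℤ.-<+ z≮0
  belowHead (+ b) _ a≮b a≢b 1≤b with ℕP.<-cmp b (suc a)
  ... | tri< b<a _ _ = ℤ.+<+ b<a , ℤ.+<+ 1≤b
  ... | tri≈ _ b≡a _ = contradiction (sym b≡a) a≢b
  ... | tri> _ _ a<b = contradiction (ℤ.+<+ a<b) a≮b

-- σ ∈ VS^(B)_{n,k} (resp. VS^(D)_{n,k}) contributing the monomial t^e.
VSBᵉ : ℕ → ℕ → ℤ → List ℤ → Set
VSBᵉ n k e σ = SignedPerm n σ × σ ! 1 ≡ + k × IsVSB σ × e ≡ deg n σ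

VSDᵉ : ℕ → ℕ → ℤ → List ℤ → Set
VSDᵉ n k e σ = SignedPerm n σ × σ ! 1 ≡ - (+ k) × IsVSD σ × e ≡ deg n σ

vsbᵉ? : ∀ n k e σ → Dec (VSBᵉ n k e σ)
vsbᵉ? n k e σ = Dec.map (mk⇔ to from) (vsb? n k σ ×-dec e ℤ.≟ deg n σ)
  where
  to : ∀ {n} → VSB n k σ × e ≡ deg n σ → VSBᵉ n k e σ
  to ((sp@(refl , _) , head , valleys) , e≡) = sp , head , Equivalence.to (vsbValleys⇔IsVSB σ head) valleys , e≡
  from : ∀ {n} → VSBᵉ n k e σ → VSB n k σ × e ≡ deg n σ
  from (sp@(refl , _) , head , isVSB , e≡) = (sp , head , Equivalence.from (vsbValleys⇔IsVSB σ head) isVSB) , e≡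

vsdᵉ? : ∀ n k e σ → Dec (VSDᵉ n k e σ)
vsdᵉ? n k e σ = Dec.map (mk⇔ to from) (vsd? n k σ ×-dec e ℤ.≟ deg n σ)
  where
  to : ∀ {n} → VSD n k σ × e ≡ deg n σ → VSDᵉ n k e σ
  to ((sp@(refl , _) , head , second , valleys) , e≡) =
    sp , head , Equivalence.to (vsdValleys⇔IsVSD σ) (second , valleys) , e≡
  from : ∀ {n} → VSDᵉ n k e σ → VSD n k σ × e ≡ deg n σ
  from (sp@(refl , _) , head , isVSD , e≡) =
    (sp , head , Equivalence.from (vsdValleys⇔IsVSD σ) isVSD) , e≡

genPoly-filter : ∀ n {P : List ℤ → Set} (P? : ∀ σ → Dec (P σ)) W e →
  genPoly n (filter P? W) e ≡ count (λ σ → does (P? σ ×-dec e ℤ.≟ deg n σ)) W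
genPoly-filter n P? [] e = refl
genPoly-filter n P? (σ ∷ W) e with does (P? σ)
... | false = genPoly-filter n P? W e
... | true with e ℤ.≟ deg n σ
...   | yes _ = cong suc (genPoly-filter n P? W e)
...   | no _ = genPoly-filter n P? W e

#VSB #VSD : ℕ → ℕ → ℤ → ℕ
#VSB n k e = count (does ∘ vsbᵉ? n k e) (words n n)
#VSD n k e = count (does ∘ vsdᵉ? n k e) (words n n)

module _ (m : ℕ) {j : ℕ} (1≤j : 1 ≤ j) (j≤1+m : j ≤ suc m) (e : ℤ) (ρ : List ℤ) where

  VSBᵉ-punchIn⇔ : VSBᵉ (suc m) j e (+ j ∷ map (punchInℤ j) ρ) ⇔
    (SignedPerm m ρ × IsVSB (+ j ∷ map (punchInℤ j) ρ) × e ℤ.- + 1 ≡ deg m ρ)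
  VSBᵉ-punchIn⇔ = mk⇔
    (λ (sp , _ , isVSB , e≡) → Equivalence.to signedPerm⇔ sp , isVSB , Equivalence.to deg⇔ e≡)
    (λ (sp , isVSB , e≡) → Equivalence.from signedPerm⇔ sp , refl , isVSB , Equivalence.from deg⇔ e≡)
    where
    σ = + j ∷ map (punchInℤ j) ρ
    signedPerm⇔ = signedPerm-punchIn 1≤j j≤1+m ρ refl
    deg⇔ : e ≡ deg (suc m) σ ⇔ e ℤ.- + 1 ≡ deg m ρ
    deg⇔ = ⇔-trans (subst⇔ (e ≡_) (deg-∷-≮ m σ ρ negσ)) (≡-+⇔-≡ e (deg m ρ) (+ 1))
      where negσ = trans (neg-∷-≮ (map (punchInℤ j) ρ) (¬+<0 j)) (neg-map (punchInℤ j) (punchInℤ-<0 j) ρ)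

  VSDᵉ-punchIn⇔ : VSDᵉ (suc m) j e (- (+ j) ∷ map (punchInℤ j) ρ) ⇔
    (SignedPerm m ρ × IsVSD (- (+ j) ∷ map (punchInℤ j) ρ) × e ℤ.- - (+ 1) ≡ deg m ρ)
  VSDᵉ-punchIn⇔ = mk⇔
    (λ (sp , _ , isVSD , e≡) → Equivalence.to signedPerm⇔ sp , isVSD , Equivalence.to deg⇔ e≡)
    (λ (sp , isVSD , e≡) → Equivalence.from signedPerm⇔ sp , refl , isVSD , Equivalence.from deg⇔ e≡)
    where
    σ = - (+ j) ∷ map (punchInℤ j) ρ
    signedPerm⇔ = signedPerm-punchIn 1≤j j≤1+m ρ (ℤP.∣-i∣≡∣i∣ (+ j))
    deg⇔ : e ≡ deg (suc m) σ ⇔ e ℤ.- - (+ 1) ≡ deg m ρ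
    deg⇔ = ⇔-trans (subst⇔ (e ≡_) (deg-∷-< m σ ρ negσ)) (≡-+⇔-≡ e (deg m ρ) (- (+ 1)))
      where negσ = trans (neg-∷-< (map (punchInℤ j) ρ) (-+<0 1≤j)) (cong suc (neg-map (punchInℤ j) (punchInℤ-<0 j) ρ))

module _ {e : ℤ} {j : ℕ} (τ : List ℤ) where

  ¬VSDᵉ-punchIn-pos≥ : ∀ {n a} → j ≤ a → ¬ VSDᵉ n j e (- (+ j) ∷ map (punchInℤ j) (+ a ∷ τ))
  ¬VSDᵉ-punchIn-pos≥ j≤a (_ , _ , isVSD , _) = ¬IsVSD-punchIn-pos≥ τ j≤a isVSD

  ¬VSDᵉ-punchIn-neg : ∀ {n a} → ¬ VSDᵉ n j e (- (+ j) ∷ map (punchInℤ j) (-[1+ a ] ∷ τ))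
  ¬VSDᵉ-punchIn-neg (_ , _ , isVSD , _) = ¬IsVSD-punchIn-neg τ isVSD

  ¬VSBᵉ-punchIn-neg< : ∀ {n a} → suc a < j → ¬ VSBᵉ n j e (+ j ∷ map (punchInℤ j) (-[1+ a ] ∷ τ))
  ¬VSBᵉ-punchIn-neg< a<j (_ , _ , isVSB , _) = ¬IsVSB-punchIn-neg< τ a<j isVSB

module _ (m : ℕ) {j : ℕ} (1≤j : 1 ≤ j) (j≤1+m : j ≤ suc m) (e : ℤ) where

  VSDᵉ-punchIn-pos< : ∀ {a} τ → a < j →
    VSDᵉ (suc m) j e (- (+ j) ∷ map (punchInℤ j) (+ a ∷ τ)) ⇔ VSBᵉ m a (e ℤ.- - (+ 1)) (+ a ∷ τ)
  VSDᵉ-punchIn-pos< τ a<j = ⇔-trans (VSDᵉ-punchIn⇔ m 1≤j j≤1+m e _) (mk⇔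
    (λ (sp , isVSD , e≡) → sp , refl , proj₂ (Equivalence.to (IsVSD-punchIn-pos< τ a<j) isVSD) , e≡)
    (λ { (sp@(_ , (1≤a , _) ∷ _ , _) , _ , isVSB , e≡) →
           sp , Equivalence.from (IsVSD-punchIn-pos< τ a<j) (1≤a , isVSB) , e≡ }))

  VSBᵉ-punchIn-pos< : ∀ {a} τ → a < j →
    VSBᵉ (suc m) j e (+ j ∷ map (punchInℤ j) (+ a ∷ τ)) ⇔ VSBᵉ m a (e ℤ.- + 1) (+ a ∷ τ)
  VSBᵉ-punchIn-pos< τ a<j = ⇔-trans (VSBᵉ-punchIn⇔ m 1≤j j≤1+m e _) (mk⇔
    (λ (sp , isVSB , e≡) → sp , refl , Equivalence.to (IsVSB-punchIn-pos< τ a<j) isVSB , e≡)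
    (λ (sp , _ , isVSB , e≡) → sp , Equivalence.from (IsVSB-punchIn-pos< τ a<j) isVSB , e≡))

  VSBᵉ-punchIn-pos≥ : ∀ {a} τ → j ≤ a →
    VSBᵉ (suc m) j e (+ j ∷ map (punchInℤ j) (+ a ∷ τ)) ⇔ (VSBᵉ m a (e ℤ.- + 1) (+ a ∷ τ) × ¬ (τ ! 1 ℤ.< + 0))
  VSBᵉ-punchIn-pos≥ τ j≤a = ⇔-trans (VSBᵉ-punchIn⇔ m 1≤j j≤1+m e _) (mk⇔
    (λ (sp , isVSB , e≡) → let (isVSB′ , τ₁≮0) = Equivalence.to (IsVSB-punchIn-pos≥ τ j≤a) isVSB
                           in (sp , refl , isVSB′ , e≡) , τ₁≮0)
    (λ ((sp , _ , isVSB , e≡) , τ₁≮0) → sp , Equivalence.from (IsVSB-punchIn-pos≥ τ j≤a) (isVSB , τ₁≮0) , e≡))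

  VSBᵉ-punchIn-descent : ∀ {a} τ → j ≤ suc a →
    (VSBᵉ (suc m) j e (+ j ∷ map (punchInℤ j) (-[1+ a ] ∷ τ)) × ¬ (+ suc a ℤ.< τ ! 1)) ⇔
    VSDᵉ m (suc a) (e ℤ.- + 1) (-[1+ a ] ∷ τ)
  VSBᵉ-punchIn-descent {a} τ j≤a = ⇔-trans (VSBᵉ-punchIn⇔ m 1≤j j≤1+m e _ ×-⇔ ⇔-refl) (mk⇔
    (λ ((sp , isVSB , e≡) , a≮τ₁) →
       sp , refl ,
       Equivalence.to (IsVSB⇔IsVSD-descent a τ sp) (Equivalence.to (IsVSB-punchIn-neg≥ τ j≤a) isVSB , a≮τ₁) , e≡)
    (λ (sp , _ , isVSD , e≡) →
       let (isVSB , a≮τ₁) = Equivalence.from (IsVSB⇔IsVSD-descent a τ sp) isVSD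
       in (sp , Equivalence.from (IsVSB-punchIn-neg≥ τ j≤a) isVSB , e≡) , a≮τ₁))

  -- ρ = (-a) τ₁ ⋯ with a < τ₁ corresponds to the word a (-τ₁) ⋯, whose second letter is negative.
  VSBᵉ-punchIn-ascent : ∀ {a} τ → j ≤ suc a →
    (VSBᵉ (suc m) j e (+ j ∷ map (punchInℤ j) (-[1+ a ] ∷ τ)) × + suc a ℤ.< τ ! 1) ⇔
    (VSBᵉ m (suc a) (e ℤ.- + 1) (+ suc a ∷ negateHead τ) × negateHead τ ! 1 ℤ.< + 0)
  VSBᵉ-punchIn-ascent [] _ = mk⇔ (λ { (_ , ℤ.+<+ ()) }) (λ { (_ , ℤ.+<+ ()) })
  VSBᵉ-punchIn-ascent (+ zero ∷ τ) _ = mk⇔ (λ { (_ , ℤ.+<+ ()) }) (λ { (_ , ℤ.+<+ ()) })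
  VSBᵉ-punchIn-ascent (-[1+ k ] ∷ τ) _ = mk⇔ (λ { (_ , ()) }) (λ { (_ , ℤ.+<+ ()) })
  VSBᵉ-punchIn-ascent {a} (+ suc k ∷ τ) j≤a =
    ⇔-trans (VSBᵉ-punchIn⇔ m 1≤j j≤1+m e (-[1+ a ] ∷ + suc k ∷ τ) ×-⇔ ⇔-refl) (mk⇔
    (λ ((sp , isVSB , e≡) , a<k) →
       (signedPerm-absList refl sp , refl ,
        ((λ _ → ℤP.drop‿+<+ a<k) , proj₂ (proj₁ (Equivalence.to (IsVSB-punchIn-neg≥ (+ suc k ∷ τ) j≤a) isVSB))) , e≡) , ℤ.-<+)
    (λ ((sp , _ , (a<k , vt) , e≡) , _) →
       (signedPerm-absList refl sp ,
        Equivalence.from (IsVSB-punchIn-neg≥ (+ suc k ∷ τ) j≤a) (((λ k<0 → contradiction k<0 (¬+<0 (suc k))) , vt) , ¬+<0 (suc k)) ,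
        e≡) ,
       ℤ.+<+ (a<k ℤ.-<+)))

module _ (m : ℕ) {j : ℕ} (1≤j : 1 ≤ j) (j≤1+m : j ≤ suc m) (e : ℤ) where

  #VSB-tail : #VSB (suc m) j e ≡ count (λ w → does (vsbᵉ? (suc m) j e (+ j ∷ w))) (words (suc m) m)
  #VSB-tail = count-words-forcedHead m 1≤j j≤1+m m _ (+ j) refl
    (λ x w accepted → proj₁ (proj₂ (does⇒ (vsbᵉ? (suc m) j e (x ∷ w)) accepted)))

  #VSD-tail : #VSD (suc m) j e ≡ count (λ w → does (vsdᵉ? (suc m) j e (- (+ j) ∷ w))) (words (suc m) m)
  #VSD-tail = count-words-forcedHead m 1≤j j≤1+m m _ (- (+ j)) (ℤP.∣-i∣≡∣i∣ (+ j))
    (λ x w accepted → proj₁ (proj₂ (does⇒ (vsdᵉ? (suc m) j e (x ∷ w)) accepted)))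

  #VSB-punchIn : #VSB (suc m) j e ≡ count (λ w → does (vsbᵉ? (suc m) j e (+ j ∷ map (punchInℤ j) w))) (words m m)
  #VSB-punchIn = trans #VSB-tail (count-words-punchIn m 1≤j j≤1+m m _
    (λ w j∈w → dec-false (vsbᵉ? (suc m) j e (+ j ∷ w)) (λ (sp , _) → signedPerm-head∉tail sp j∈w)))

  #VSD-punchIn : #VSD (suc m) j e ≡ count (λ w → does (vsdᵉ? (suc m) j e (- (+ j) ∷ map (punchInℤ j) w))) (words m m)
  #VSD-punchIn = trans #VSD-tail (count-words-punchIn m 1≤j j≤1+m m _
    (λ w j∈w → dec-false (vsdᵉ? (suc m) j e (- (+ j) ∷ w))
      (λ (sp , _) → signedPerm-head∉tail sp (subst (λ c → Any (λ y → ∣ y ∣ ≡ c) w) (sym (ℤP.∣-i∣≡∣i∣ (+ j))) j∈w))))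

-- The recurrences

#VSD-rec : ∀ m {j} e → 1 ≤ j → j ≤ 2 + m →
  #VSD (2 + m) j e ≡ sumFrom 1 (j ∸ 1) (λ a → #VSB (suc m) a (e ℤ.- - (+ 1)))
#VSD-rec m {suc j′} e 1≤j j≤2+m = begin
  #VSD (2 + m) j e
    ≡⟨ #VSD-punchIn (suc m) 1≤j j≤2+m e ⟩
  count accepts (words (suc m) (suc m))
    ≡⟨ count-words-byHeadSign (suc m) m accepts ⟩
  sumFrom 1 (suc m) (λ a → count (accepts ∘ (+ a ∷_)) W) + sumFrom 1 (suc m) (λ a → count (accepts ∘ (- (+ a) ∷_)) W)
    ≡⟨ cong₂ _+_ (sumFrom-truncate j′ (suc m) (ℕP.≤-pred j≤2+m) secondBelow secondAbove)
                 (sumFrom-≡0 1 (suc m) λ { (suc a) _ _ → count-≡0 _ (λ τ → rejected (¬VSDᵉ-punchIn-neg τ)) W }) ⟩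
  sumFrom 1 j′ (λ a → #VSB (suc m) a e′) + 0
    ≡⟨ ℕP.+-identityʳ _ ⟩
  sumFrom 1 j′ (λ a → #VSB (suc m) a e′)
    ∎
  where
  open ≡-Reasoning
  j = suc j′
  e′ = e ℤ.- - (+ 1)
  W = words (suc m) m
  rejected : ∀ {σ} → ¬ VSDᵉ (2 + m) j e σ → does (vsdᵉ? (2 + m) j e σ) ≡ false
  rejected {σ} = dec-false (vsdᵉ? (2 + m) j e σ)
  accepts : List ℤ → Bool
  accepts w = does (vsdᵉ? (2 + m) j e (- (+ j) ∷ map (punchInℤ j) w))
  secondBelow : ∀ a → 1 ≤ a → a ≤ j′ → count (accepts ∘ (+ a ∷_)) W ≡ #VSB (suc m) a e′
  secondBelow a 1≤a a≤j′ = begin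
    count (accepts ∘ (+ a ∷_)) W
      ≡⟨ count-cong (λ τ → does-⇔ (VSDᵉ-punchIn-pos< (suc m) 1≤j j≤2+m e τ (s≤s a≤j′))
                                    (vsdᵉ? (2 + m) j e _) (vsbᵉ? (suc m) a e′ (+ a ∷ τ))) W ⟩
    count (λ τ → does (vsbᵉ? (suc m) a e′ (+ a ∷ τ))) W
      ≡⟨ #VSB-tail m 1≤a (ℕP.≤-trans a≤j′ (ℕP.≤-pred j≤2+m)) e′ ⟨
    #VSB (suc m) a e′
      ∎
  secondAbove : ∀ a → j′ < a → a ≤ suc m → count (accepts ∘ (+ a ∷_)) W ≡ 0
  secondAbove a j≤a _ = count-≡0 _ (λ τ → rejected (¬VSDᵉ-punchIn-pos≥ τ j≤a)) W

#VSB-rec : ∀ m {j} e → 1 ≤ j → j ≤ 2 + m →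
  #VSB (2 + m) j e ≡
  sumFrom 1 (suc m) (λ a → #VSB (suc m) a (e ℤ.- + 1)) + sumFrom j (2 + m ∸ j) (λ a → #VSD (suc m) a (e ℤ.- + 1))
#VSB-rec m {j} e 1≤j j≤2+m = begin
  #VSB (2 + m) j e
    ≡⟨ #VSB-punchIn (suc m) 1≤j j≤2+m e ⟩
  count accepts (words (suc m) (suc m))
    ≡⟨ count-words-byHeadSign (suc m) m accepts ⟩
  sumFrom 1 (suc m) firstPos + sumFrom 1 (suc m) firstNeg
    ≡⟨ sumFrom-distrib 1 (suc m) firstPos firstNeg ⟩
  sumFrom 1 (suc m) (λ a → firstPos a + firstNeg a)
    ≡⟨ sumFrom-cong 1 (suc m) (λ { (suc a) _ a<2+m → byFirst (suc a) (s≤s z≤n) (ℕP.≤-pred a<2+m) }) ⟩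
  sumFrom 1 (suc m) (λ a → #VSB (suc m) a e′ + restrictFrom j (λ a → #VSD (suc m) a e′) a)
    ≡⟨ sumFrom-distrib 1 (suc m) (λ a → #VSB (suc m) a e′) (restrictFrom j (λ a → #VSD (suc m) a e′)) ⟨
  sumFrom 1 (suc m) (λ a → #VSB (suc m) a e′) + sumFrom 1 (suc m) (restrictFrom j (λ a → #VSD (suc m) a e′))
    ≡⟨ cong (_+_ (sumFrom 1 (suc m) (λ a → #VSB (suc m) a e′))) (sumFrom-restrictFrom j (suc m) _ 1≤j j≤2+m) ⟩
  sumFrom 1 (suc m) (λ a → #VSB (suc m) a e′) + sumFrom j (2 + m ∸ j) (λ a → #VSD (suc m) a e′)
    ∎
  where
  open ≡-Reasoning
  e′ = e ℤ.- + 1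
  W = words (suc m) m
  accepts : List ℤ → Bool
  accepts w = does (vsbᵉ? (2 + m) j e (+ j ∷ map (punchInℤ j) w))
  firstPos firstNeg : ℕ → ℕ
  firstPos a = count (accepts ∘ (+ a ∷_)) W
  firstNeg a = count (accepts ∘ (- (+ a) ∷_)) W
  isVSBAt : ℕ → List ℤ → Bool
  isVSBAt a τ = does (vsbᵉ? (suc m) a e′ (+ a ∷ τ))
  isNeg₁ : List ℤ → Bool
  isNeg₁ τ = does (τ ! 1 ℤ.<? + 0)
  firstBelow : ∀ a → 1 ≤ a → a ≤ suc m → a < j →
    firstPos a + firstNeg a ≡ #VSB (suc m) a e′ + restrictFrom j (λ a → #VSD (suc m) a e′) a
  firstBelow (suc a) 1≤a a≤1+m a<j = cong₂ _+_
    (begin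
      firstPos (suc a)
        ≡⟨ count-cong (λ τ → does-⇔ (VSBᵉ-punchIn-pos< (suc m) 1≤j j≤2+m e τ a<j)
                                     (vsbᵉ? (2 + m) j e _) (vsbᵉ? (suc m) (suc a) e′ _)) W ⟩
      count (isVSBAt (suc a)) W
        ≡⟨ #VSB-tail m 1≤a a≤1+m e′ ⟨
      #VSB (suc m) (suc a) e′
        ∎)
    (trans (count-≡0 _ (λ τ → dec-false (vsbᵉ? (2 + m) j e _) (¬VSBᵉ-punchIn-neg< τ a<j)) W)
           (sym (restrictFrom-< _ a<j)))
  firstAbove : ∀ a → 1 ≤ a → a ≤ suc m → j ≤ a →
    firstPos a + firstNeg a ≡ #VSB (suc m) a e′ + restrictFrom j (λ a → #VSD (suc m) a e′) a
  firstAbove (suc a) 1≤a a≤1+m j≤a = begin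
    firstPos (suc a) + firstNeg (suc a)
      ≡⟨ cong₂ _+_ (count-cong (λ τ → does-⇔ (VSBᵉ-punchIn-pos≥ (suc m) 1≤j j≤2+m e τ j≤a) (vsbᵉ? (2 + m) j e _)
                                               (vsbᵉ? (suc m) (suc a) e′ _ ×-dec ¬? (τ ! 1 ℤ.<? + 0))) W)
                   (count-∧-split _ (λ τ → does (+ suc a ℤ.<? τ ! 1)) W) ⟩
      secondNonneg + (count ascent W + count descent W)
      ≡⟨ cong (_+_ secondNonneg) (cong₂ _+_ ascents descents) ⟩
      secondNonneg + (secondNeg + #VSD (suc m) (suc a) e′)
      ≡⟨ regroup secondNonneg secondNeg (#VSD (suc m) (suc a) e′) ⟩
      (secondNeg + secondNonneg) + #VSD (suc m) (suc a) e′
      ≡⟨ cong₂ _+_ (trans (sym (count-∧-split (isVSBAt (suc a)) isNeg₁ W)) (sym (#VSB-tail m 1≤a a≤1+m e′)))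
                   (sym (restrictFrom-≥ _ j≤a)) ⟩
      #VSB (suc m) (suc a) e′ + restrictFrom j (λ a → #VSD (suc m) a e′) (suc a)
      ∎
    where
    secondNeg secondNonneg : ℕ
    secondNeg = count (λ τ → isVSBAt (suc a) τ ∧ isNeg₁ τ) W
    secondNonneg = count (λ τ → isVSBAt (suc a) τ ∧ not (isNeg₁ τ)) W
    ascent descent : List ℤ → Bool
    ascent τ = does (vsbᵉ? (2 + m) j e (+ j ∷ map (punchInℤ j) (-[1+ a ] ∷ τ)) ×-dec (+ suc a ℤ.<? τ ! 1))
    descent τ = does (vsbᵉ? (2 + m) j e (+ j ∷ map (punchInℤ j) (-[1+ a ] ∷ τ)) ×-dec ¬? (+ suc a ℤ.<? τ ! 1))
    ascents : count ascent W ≡ secondNeg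
    ascents = trans (count-cong (λ τ → does-⇔ (VSBᵉ-punchIn-ascent (suc m) 1≤j j≤2+m e τ j≤a)
                                               (vsbᵉ? (2 + m) j e _ ×-dec (+ suc a ℤ.<? τ ! 1))
                                               (vsbᵉ? (suc m) (suc a) e′ _ ×-dec (negateHead τ ! 1 ℤ.<? + 0))) W)
                    (sym (count-words-negateHead (suc m) m (λ τ → isVSBAt (suc a) τ ∧ isNeg₁ τ)))
    descents : count descent W ≡ #VSD (suc m) (suc a) e′
    descents = trans (count-cong (λ τ → does-⇔ (VSBᵉ-punchIn-descent (suc m) 1≤j j≤2+m e τ j≤a)
                                                (vsbᵉ? (2 + m) j e _ ×-dec ¬? (+ suc a ℤ.<? τ ! 1))
                                                (vsdᵉ? (suc m) (suc a) e′ _)) W)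
                     (sym (#VSD-tail m 1≤a a≤1+m e′))
    regroup : ∀ x y z → x + (y + z) ≡ (y + x) + z
    regroup = solve-∀
  byFirst : ∀ a → 1 ≤ a → a ≤ suc m →
    firstPos a + firstNeg a ≡ #VSB (suc m) a e′ + restrictFrom j (λ a → #VSD (suc m) a e′) a
  byFirst a 1≤a a≤1+m with ℕP.<-cmp a j
  ... | tri< a<j _ _ = firstBelow a 1≤a a≤1+m a<j
  ... | tri≈ _ refl _ = firstAbove a 1≤a a≤1+m ℕP.≤-refl
  ... | tri> _ _ j<a = firstAbove a 1≤a a≤1+m (ℕP.<⇒≤ j<a)

#VSB-step : ∀ m {T} e → 1 ≤ T → T ≤ suc m →
  #VSB (2 + m) T e ≡ #VSB (2 + m) (suc T) e + #VSD (suc m) T (e ℤ.- + 1)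
#VSB-step m {T} e 1≤T T≤1+m = begin
  #VSB (2 + m) T e
    ≡⟨ #VSB-rec m e 1≤T (ℕP.m≤n⇒m≤1+n T≤1+m) ⟩
  S + sumFrom T (2 + m ∸ T) D
    ≡⟨ cong (λ t → S + sumFrom T t D) (ℕP.+-∸-assoc 1 T≤1+m) ⟩
  S + (D T + sumFrom (suc T) (suc m ∸ T) D)
    ≡⟨ swap S (D T) _ ⟩
  (S + sumFrom (suc T) (suc m ∸ T) D) + D T
    ≡⟨ cong (_+ D T) (#VSB-rec m e (s≤s z≤n) (s≤s T≤1+m)) ⟨
  #VSB (2 + m) (suc T) e + D T
    ∎
  where
  open ≡-Reasoning
  S = sumFrom 1 (suc m) (λ a → #VSB (suc m) a (e ℤ.- + 1))
  D = λ a → #VSD (suc m) a (e ℤ.- + 1)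
  swap : ∀ x y z → x + (y + z) ≡ (x + z) + y
  swap = solve-∀

#VSB-last : ∀ m e → #VSB (2 + m) (2 + m) e ≡ sumFrom 1 (suc m) (λ a → #VSB (suc m) a (e ℤ.- + 1))
#VSB-last m e = begin
  #VSB (2 + m) (2 + m) e
    ≡⟨ #VSB-rec m e (s≤s z≤n) ℕP.≤-refl ⟩
  S + sumFrom (2 + m) (2 + m ∸ (2 + m)) (λ a → #VSD (suc m) a (e ℤ.- + 1))
    ≡⟨ cong (λ t → S + sumFrom (2 + m) t (λ a → #VSD (suc m) a (e ℤ.- + 1))) (ℕP.n∸n≡0 m) ⟩
  S + 0
    ≡⟨ ℕP.+-identityʳ S ⟩
  S ∎
  where
  open ≡-Reasoning
  S = sumFrom 1 (suc m) (λ a → #VSB (suc m) a (e ℤ.- + 1))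

m∸n+1≤1+m : ∀ m n → m ∸ n + 1 ≤ suc m
m∸n+1≤1+m m n = subst (_≤ suc m) (ℕP.+-comm 1 (m ∸ n)) (s≤s (ℕP.m∸n≤m m n))

Claim : ℕ → Set
Claim n = ∀ k → 1 ≤ k → k ≤ n → ∀ e → Vpos n k e ≡ #VSB n (n ∸ k + 1) e × Vneg n k e ≡ #VSD n (n ∸ k + 1) e

claim-1 : Claim 1
claim-1 (suc zero) _ _ e with e ℤ.≟ + 2 | e ℤ.≟ + 0
... | yes _ | yes _ = refl , refl
... | yes _ | no _ = refl , refl
... | no _ | yes _ = refl , refl
... | no _ | no _ = refl , refl
claim-1 (suc (suc _)) _ (s≤s ())

module ClaimStep (m : ℕ) (IH : Claim (suc m)) where

  negAux≡sumFrom : ∀ d → d ≤ suc m → ∀ e → negAux (suc m) d e ≡ sumFrom 1 d (λ a → #VSB (suc m) a (e ℤ.- - (+ 1)))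
  negAux≡sumFrom zero _ e = refl
  negAux≡sumFrom (suc d) d<1+m e = begin
    negAux (suc m) d e + Vpos (suc m) (suc m ∸ d) e′
      ≡⟨ cong₂ _+_ (negAux≡sumFrom d (ℕP.<⇒≤ d<1+m) e)
                   (proj₁ (IH (suc m ∸ d) (ℕP.m<n⇒0<n∸m d<1+m) (ℕP.m∸n≤m (suc m) d) e′)) ⟩
    sumFrom 1 d b + #VSB (suc m) (suc m ∸ (suc m ∸ d) + 1) e′
      ≡⟨ cong (λ t → sumFrom 1 d b + #VSB (suc m) (t + 1) e′) (ℕP.m∸[m∸n]≡n (ℕP.<⇒≤ d<1+m)) ⟩
    sumFrom 1 d b + b (d + 1)
      ≡⟨ cong (λ t → sumFrom 1 d b + b t) (ℕP.+-comm d 1) ⟩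
    sumFrom 1 d b + b (suc d)
      ≡⟨ sumFrom-last d b ⟨
    sumFrom 1 (suc d) b
      ∎
    where
    open ≡-Reasoning
    e′ = e ℤ.- - (+ 1)
    b = λ a → #VSB (suc m) a e′

  Vneg≡#VSD : ∀ k → 1 ≤ k → k ≤ 2 + m → ∀ e → Vneg (2 + m) k e ≡ #VSD (2 + m) (2 + m ∸ k + 1) e
  Vneg≡#VSD k@(suc k′) 1≤k k≤2+m e = begin
    negAux (suc m) (2 + m ∸ k) e
      ≡⟨ negAux≡sumFrom (2 + m ∸ k) (ℕP.∸-monoʳ-≤ (2 + m) 1≤k) e ⟩
    sumFrom 1 (2 + m ∸ k) (λ a → #VSB (suc m) a (e ℤ.- - (+ 1)))
      ≡⟨ cong (λ t → sumFrom 1 t (λ a → #VSB (suc m) a (e ℤ.- - (+ 1)))) (ℕP.m+n∸n≡m (2 + m ∸ k) 1) ⟨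
    sumFrom 1 (2 + m ∸ k + 1 ∸ 1) (λ a → #VSB (suc m) a (e ℤ.- - (+ 1)))
      ≡⟨ #VSD-rec m e (ℕP.m≤n+m 1 _) (m∸n+1≤1+m (suc m) k′) ⟨
    #VSD (2 + m) (2 + m ∸ k + 1) e
      ∎
    where open ≡-Reasoning

  Vpos≡#VSB : ∀ k → 1 ≤ k → k ≤ 2 + m → ∀ e → Vpos (2 + m) k e ≡ #VSB (2 + m) (2 + m ∸ k + 1) e
  Vpos≡#VSB 1 _ _ e = begin
    Vneg (2 + m) 1 (e ℤ.- + 2)
      ≡⟨ Vneg≡#VSD 1 (s≤s z≤n) (s≤s z≤n) (e ℤ.- + 2) ⟩
    #VSD (2 + m) (suc m + 1) (e ℤ.- + 2)
      ≡⟨ cong (λ t → #VSD (2 + m) t (e ℤ.- + 2)) (ℕP.+-comm (suc m) 1) ⟩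
    #VSD (2 + m) (2 + m) (e ℤ.- + 2)
      ≡⟨ #VSD-rec m (e ℤ.- + 2) (s≤s z≤n) ℕP.≤-refl ⟩
    sumFrom 1 (suc m) (λ a → #VSB (suc m) a ((e ℤ.- + 2) ℤ.- - (+ 1)))
      ≡⟨ cong (λ x → sumFrom 1 (suc m) (λ a → #VSB (suc m) a x)) (shuffle e) ⟩
    sumFrom 1 (suc m) (λ a → #VSB (suc m) a (e ℤ.- + 1))
      ≡⟨ #VSB-last m e ⟨
    #VSB (2 + m) (2 + m) e
      ≡⟨ cong (λ t → #VSB (2 + m) t e) (ℕP.+-comm 1 (suc m)) ⟩
    #VSB (2 + m) (suc m + 1) e
      ∎
    where
    open ≡-Reasoning
    shuffle : ∀ e → (e ℤ.- + 2) ℤ.- - (+ 1) ≡ e ℤ.- + 1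
    shuffle = solveℤ
  Vpos≡#VSB (suc (suc k)) _ (s≤s k<1+m) e = begin
    Vpos (2 + m) (suc k) e + Vneg (suc m) (suc k) (e ℤ.- + 1)
      ≡⟨ cong₂ _+_ (Vpos≡#VSB (suc k) (s≤s z≤n) (ℕP.m≤n⇒m≤1+n k<1+m) e)
                   (proj₂ (IH (suc k) (s≤s z≤n) k<1+m (e ℤ.- + 1))) ⟩
    #VSB (2 + m) (suc m ∸ k + 1) e + #VSD (suc m) T (e ℤ.- + 1)
      ≡⟨ cong (λ t → #VSB (2 + m) (t + 1) e + #VSD (suc m) T (e ℤ.- + 1)) (ℕP.+-∸-assoc 1 (ℕP.≤-pred k<1+m)) ⟩
    #VSB (2 + m) (suc T) e + #VSD (suc m) T (e ℤ.- + 1)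
      ≡⟨ #VSB-step m e (ℕP.m≤n+m 1 _) (m∸n+1≤1+m m k) ⟨
    #VSB (2 + m) T e
      ∎
    where
    open ≡-Reasoning
    T = m ∸ k + 1

claim : ∀ n → Claim n
claim zero k 1≤k k≤0 = contradiction (ℕP.≤-trans 1≤k k≤0) λ ()
claim (suc zero) = claim-1
claim (suc (suc m)) k 1≤k k≤n e = Vpos≡#VSB k 1≤k k≤n e , Vneg≡#VSD k 1≤k k≤n e
  where open ClaimStep m (claim (suc m))

theorem2p2 : (n k : ℕ) → 1 ≤ k → k ≤ n →
    ((e : ℤ) → V n (+ k) e ≡ genPoly n (VSBset n (n ∸ k + 1)) e)
    × ((e : ℤ) → V n (- (+ k)) e ≡ genPoly n (VSDset n (n ∸ k + 1)) e)
theorem2p2 n (suc k) 1≤k k≤n =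
  (λ e → trans (proj₁ (claim n (suc k) 1≤k k≤n e)) (sym (genPoly-filter n (vsb? n (n ∸ suc k + 1)) (words n n) e))) ,
  (λ e → trans (proj₂ (claim n (suc k) 1≤k k≤n e)) (sym (genPoly-filter n (vsd? n (n ∸ suc k + 1)) (words n n) e)))
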